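{- Let $h\in\mathbb N$, $u,v\in\mathfrak S_n$ with $u<v$, and $F$ an $h$-flipclass of paths from $u$ to $v$. The following are equivalent: (1) the map $i_{TS_F}$ from $F$ to the set $P$ of directed paths of length $h$ from $(u,0)$ to $(v,h)$ in $TS_F$ is bijective, i.e. every such path in $TS_F$ is effective; (2) for all $(a,i),(b,i+2)\in V(TS_F)$ with $(a,i)\le(b,i+2)$, the interval $[(a,i),(b,i+2)]$ in the poset induced by $TS_F$ is a diamond, and moreover the flip operators $f'_1,\dots,f'_{h-1}$ on $P$ act transitively on $P$, where $f'_i$ replaces the vertex at time $i$ of a path by the other middle element of the diamond formed by the interval between its vertices at times $i-1$ and $i+1$.
   Context: $\mathfrak S_n$: symmetric group on $[n]$, $\ell$ Coxeter length, $T$ transpositions. Bruhat graph: edge $x\to y$ whenever $yx^{ -1}\in T$ and $\ell(x)<\ell(y)$. $P_h(u,v)$: directed paths of length $h$ from $u$ to $v$. Between two elements there are 0 or 2 paths of length 2, each the flip of the other; $f_i$ replaces the subpath $x_{i-1}\to x_i\to x_{i+1}$ by its flip; the $h$-flipclasses of paths from $u$ to $v$ are the orbits in $P_h(u,v)$ of the group generated by $f_1,\dots,f_{h-1}$. The time-support graph $TS_F$ has vertices $(a,j)$ such that some path $x_0\to\cdots\to x_h$ of $F$ has $x_j=a$, and an edge $(a,j)\to(b,j+1)$ whenever some path of $F$ has $x_j=a,x_{j+1}=b$; it induces a partial order on its vertices (reachability). $i_{TS_F}$ sends $x_0\to\cdots\to x_h\in F$ to $(x_0,0)\to\cdots\to(x_h,h)$;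 a path of $TS_F$ is effective if it is a subpath of $i_{TS_F}(\Gamma)$ for some $\Gamma\in F$. A diamond is a poset consisting of a minimum, a maximum and exactly two incomparable elements in between. -}

module Defs where

open import Data.Nat using (ℕ; zero; suc; _<_; _+_)
open import Data.Fin as Fin using (Fin; toℕ; inject₁; fromℕ; _≟_)
open import Data.Fin.Properties as FinP using ()
open import Data.Vec using (Vec; lookup; tabulate)
open import Data.List using (List; length; filter; cartesianProduct; allFin)
open import Data.Product using (Σ; _×_; _,_; proj₁; proj₂; ∃)
open import Data.Sum using (_⊎_)
open import Data.Bool using (if_then_else_)
open import Relation.Nullary using (¬_; ⌊_⌋)
open import Relation.Nullary.Decidable using (_×-dec_)
open import Relation.Binary.PropositionalEquality using (_≡_; _≢_)
open import Relation.Binary.Construct.Closure.ReflexiveTransitive using (Star)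
open import Relation.Binary.Construct.Closure.Transitive using (TransClosure)
open import Function.Bundles using (_⇔_)

-- The symmetric group S_n, in one-line notation: x = (x(0), …, x(n-1)).

Perm : ℕ → Set
Perm n = Vec (Fin n) n

IsPerm : ∀ {n} → Perm n → Set
IsPerm {n} x = ∀ (i j : Fin n) → lookup x i ≡ lookup x j → i ≡ j

-- Coxeter length = number of inversions
ℓ : ∀ {n} → Perm n → ℕ
ℓ {n} x = length (filter
  (λ p → (proj₁ p Fin.<? proj₂ p) ×-dec (lookup x (proj₂ p) Fin.<? lookup x (proj₁ p)))
  (cartesianProduct (allFin n) (allFin n)))

transp : ∀ {n} → Fin n → Fin n → Fin n → Fin n
transp a b k = if ⌊ k ≟ a ⌋ then b else (if ⌊ k ≟ b ⌋ then a else k)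

-- composition t ∘ x  (so (t ∘ x) x⁻¹ = t)
_∘ₚ_ : ∀ {n} → (Fin n → Fin n) → Perm n → Perm n
t ∘ₚ x = tabulate (λ i → t (lookup x i))

BEdge : ∀ {n} → Perm n → Perm n → Set
BEdge {n} x y =
  (Σ (Fin n) λ a → Σ (Fin n) λ b → a ≢ b × y ≡ transp a b ∘ₚ x) × ℓ x < ℓ y

_<B_ : ∀ {n} → Perm n → Perm n → Set
_<B_ = TransClosure BEdge

-- Paths of length h: x₀ → x₁ → … → x_h, stored as a vector of length h+1

BPath : ℕ → ℕ → Set
BPath n h = Vec (Perm n) (suc h)

IsBPath : ∀ {n h} → BPath n h → Set
IsBPath {n} {h} Γ = ∀ (t : Fin h) → BEdge (lookup Γ (inject₁ t)) (lookup Γ (Fin.suc t))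

InP : ∀ {n} h → Perm n → Perm n → BPath n h → Set
InP h u v Γ = IsBPath Γ × lookup Γ Fin.zero ≡ u × lookup Γ (fromℕ h) ≡ v

Consec : ∀ {h} → Fin (suc h) → Fin (suc h) → Fin (suc h) → Set
Consec p q r = toℕ q ≡ suc (toℕ p) × toℕ r ≡ suc (toℕ q)

AgreeOff : ∀ {A : Set} {m} → Fin m → Vec A m → Vec A m → Set
AgreeOff q Γ Γ' = ∀ t → t ≢ q → lookup Γ t ≡ lookup Γ' t

-- Γ' = f_q Γ: the subpath x_{q-1} → x_q → x_{q+1} is replaced by its flip
-- x_{q-1} → z → x_{q+1} with z ≠ x_q  (the other of the two paths of length 2)
Flip : ∀ {n h} → BPath n h → BPath n h → Set
Flip {n} {h} Γ Γ' = Σ (Fin (suc h)) λ p → Σ (Fin (suc h)) λ q → Σ (Fin (suc h)) λ r →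
  Consec p q r × AgreeOff q Γ Γ' × lookup Γ' q ≢ lookup Γ q ×
  BEdge (lookup Γ p) (lookup Γ' q) × BEdge (lookup Γ' q) (lookup Γ r)

-- the h-flipclass F of Γ₀ (orbit of Γ₀ under ⟨f₁,…,f_{h-1}⟩; each f_i is an involution)
FlipClass : ∀ {n h} → BPath n h → BPath n h → Set
FlipClass Γ₀ Γ = Star Flip Γ₀ Γ

module TS {n h : ℕ} (Γ₀ : BPath n h) where

  F : BPath n h → Set
  F = FlipClass Γ₀

  V : Set
  V = Perm n × Fin (suc h)

  Vert : V → Set
  Vert (a , j) = Σ (BPath n h) λ Γ → F Γ × lookup Γ j ≡ a

  Edge : V → V → Set
  Edge (a , i) (b , k) = Σ (Fin h) λ j → inject₁ j ≡ i × Fin.suc j ≡ k ×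
    (Σ (BPath n h) λ Γ → F Γ × lookup Γ (inject₁ j) ≡ a × lookup Γ (Fin.suc j) ≡ b)

  _≤_ : V → V → Set
  x ≤ y = Vert x × Vert y × Star Edge x y

  Interval : V → V → V → Set
  Interval x y z = x ≤ z × z ≤ y

  IsDiamond : (V → Set) → Set
  IsDiamond Q = Σ V λ m → Σ V λ M → Σ V λ c → Σ V λ d →
    Q m × Q M × Q c × Q d ×
    (∀ z → Q z → m ≤ z × z ≤ M) ×
    (∀ z → Q z → z ≡ m ⊎ z ≡ M ⊎ z ≡ c ⊎ z ≡ d) ×
    ¬ (c ≤ d) × ¬ (d ≤ c)

  TSPath : Set
  TSPath = Vec V (suc h)

  InPTS : Perm n → Perm n → TSPath → Set
  InPTS u v π = (∀ (t : Fin h) → Edge (lookup π (inject₁ t)) (lookup π (Fin.suc t))) ×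
    lookup π Fin.zero ≡ (u , Fin.zero) × lookup π (fromℕ h) ≡ (v , fromℕ h)

  iTS : BPath n h → TSPath
  iTS Γ = tabulate (λ t → (lookup Γ t , t))

  Flip' : TSPath → TSPath → Set
  Flip' π π' = Σ (Fin (suc h)) λ p → Σ (Fin (suc h)) λ q → Σ (Fin (suc h)) λ r →
    Consec p q r × AgreeOff q π π' ×
    Interval (lookup π p) (lookup π r) (lookup π' q) ×
    lookup π' q ≢ lookup π p × lookup π' q ≢ lookup π r × lookup π' q ≢ lookup π q

  Cond1 : Perm n → Perm n → Set
  Cond1 u v =
    (∀ Γ Γ' → F Γ → F Γ' → iTS Γ ≡ iTS Γ' → Γ ≡ Γ') ×
    (∀ π → InPTS u v π → Σ (BPath n h) λ Γ → F Γ × iTS Γ ≡ π)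

  Cond2 : Perm n → Perm n → Set
  Cond2 u v =
    (∀ (a b : Perm n) (i k : Fin (suc h)) → toℕ k ≡ 2 + toℕ i →
       (a , i) ≤ (b , k) → IsDiamond (Interval (a , i) (b , k))) ×
    (∀ π π' → InPTS u v π → InPTS u v π' → Star Flip' π π')

{-# OPTIONS --safe #-}
-- Flips of paths of F and the flips f' of their images under i_{TS_F} correspond to
-- each other.  Hence if every path of P is effective, transitivity of the f' on P is
-- inherited from F; conversely, transitivity carries effectiveness from i_{TS_F}(Γ₀)
-- to all of P.  For the diamonds: (a,i) ≤ (b,i+2) yields edges (a,i) → (c,i+1) →
-- (b,i+2) of TS_F, and splicing paths of F through a and b with c gives a path of P,
-- which is effective, so some Γ ∈ F passes through a, c and b.  In the Bruhat graph of
-- S_n every path a → c → b has exactly one flip a → c' → b (the two transpositions are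
-- disjoint or form a 3-cycle), flipping Γ puts (c',i+1) into TS_F, and nothing else
-- lies strictly between (a,i) and (b,i+2).

module Submission where

open import Defs
open import Data.Nat as ℕ using (ℕ; zero; suc; _+_; _<ᵇ_; z≤n; s≤s)
open import Data.Nat.Properties as ℕ
  using ( n<1+n; n≤1+n; +-0-commutativeMonoid; +-mono-≤; +-mono-<-≤; +-mono-≤-<; ≤-refl; ≤-reflexive
        ; ≤-trans; ≤-antisym; ≤-pred; <⇒≤; <-asym; <-irrefl; <-trans; <-≤-trans; <⇒≱; ≮⇒≥
        ; <ᵇ⇒<; <⇒<ᵇ; 0≢1+n; 1+n≢n; m≢1+n+m)
open import Data.Fin as Fin using (Fin; toℕ; inject₁; fromℕ; fromℕ<; punchOut; _≟_; _<_; _<?_; _≤?_)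
open import Data.Fin.Properties as Fin
  using ( toℕ-injective; toℕ-inject₁; toℕ-fromℕ<; toℕ-fromℕ; toℕ<n; toℕ≤pred[n]
        ; pigeonhole; punchOut-injective; ≤∧≢⇒<)
open import Data.Fin.Induction using (<-weakInduction)
open import Data.Fin.Permutation as Permutation using (Permutation; _⟨$⟩ʳ_)
import Data.Fin.Permutation.Components as PermutationComponents
open import Data.Vec using (Vec; lookup; tabulate; _[_]≔_)
open import Data.Vec.Properties
  using (lookup∘tabulate; tabulate∘lookup; tabulate-cong; lookup∘update; lookup∘update′)
import Data.List as List
open import Data.List using (List; length; filter; cartesianProduct; _++_)
open import Data.List.Properties using (filter-++; length-++; map-tabulate)
open import Data.Bool as Bool using (Bool; true; false; not; T; _xor_; if_then_else_)
import Data.Bool.Properties as Bool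
open import Data.Bool.Properties using (T-≡)
open import Data.Product as Product using (Σ; ∃₂; _×_; _,_; proj₁; proj₂)
open import Data.Product.Function.NonDependent.Propositional using (_×-⇔_)
open import Data.Sum as Sum using (_⊎_; inj₁; inj₂)
open import Data.Empty using (⊥-elim)
open import Function using (id; _∘_)
open import Function.Bundles using (_⇔_; mk⇔; Equivalence)
open import Function.Construct.Composition using (_⇔-∘_)
open import Function.Construct.Symmetry using (⇔-sym)
open import Relation.Nullary using (¬_; Dec; yes; no; does; contradiction)
open import Relation.Nullary.Decidable using (_×-dec_; dec-true; dec-false)
open import Relation.Unary using (Pred; Decidable)
open import Level using (0ℓ)
open import Relation.Binary using (tri<; tri≈; tri>)
open import Relation.Binary.Definitions using (_Respects_)
open import Relation.Binary.PropositionalEquality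
open import Relation.Binary.Construct.Closure.ReflexiveTransitive using (Star; ε; _◅_; _◅◅_)
open import Algebra.Properties.CommutativeMonoid.Sum +-0-commutativeMonoid
  using (sum; ∑-comm; ∑-permute; sum-cong-≗)

vec-ext : ∀ {A : Set} {m} {xs ys : Vec A m} → (∀ k → lookup xs k ≡ lookup ys k) → xs ≡ ys
vec-ext {xs = xs} {ys} eq = begin
  xs                    ≡⟨ tabulate∘lookup xs ⟨
  tabulate (lookup xs)  ≡⟨ tabulate-cong eq ⟩
  tabulate (lookup ys)  ≡⟨ tabulate∘lookup ys ⟩
  ys                    ∎
  where open ≡-Reasoning

IsPerm⇒surjective : ∀ {n} (x : Perm n) → IsPerm x → ∀ α → Σ (Fin n) λ i → lookup x i ≡ α
IsPerm⇒surjective {suc m} x x-perm α with Fin.any? (λ i → lookup x i ≟ α)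
... | yes found = found
... | no missed = ⊥-elim (no-collision (pigeonhole (n<1+n m) (λ i → punchOut (≢α i))))
  where
  ≢α : ∀ i → α ≢ lookup x i
  ≢α i α≡xi = missed (i , sym α≡xi)
  no-collision : ¬ ∃₂ λ i j → i Fin.< j × punchOut (≢α i) ≡ punchOut (≢α j)
  no-collision (i , j , i<j , eq) = Fin.<⇒≢ i<j (x-perm i j (punchOut-injective (≢α i) (≢α j) eq))

module _ {n : ℕ} where

  transp-left : (a b : Fin n) → transp a b a ≡ b
  transp-left a b with a ≟ a
  ... | yes _  = refl
  ... | no a≢a = contradiction refl a≢a

  transp-right : (a b : Fin n) → transp a b b ≡ a
  transp-right a b with b ≟ a
  ... | yes b≡a = b≡a
  ... | no _ with b ≟ b
  ...   | yes _  = refl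
  ...   | no b≢b = contradiction refl b≢b

  transp-other : {a b k : Fin n} → k ≢ a → k ≢ b → transp a b k ≡ k
  transp-other {a} {b} {k} k≢a k≢b with k ≟ a
  ... | yes k≡a = contradiction k≡a k≢a
  ... | no _ with k ≟ b
  ...   | yes k≡b = contradiction k≡b k≢b
  ...   | no _    = refl

  data TranspView (a b k : Fin n) : Set where
    at-left   : k ≡ a → TranspView a b k
    at-right  : k ≡ b → TranspView a b k
    elsewhere : k ≢ a → k ≢ b → TranspView a b k

  transpView : (a b k : Fin n) → TranspView a b k
  transpView a b k with k ≟ a | k ≟ b
  ... | yes k≡a | _       = at-left k≡a
  ... | no _    | yes k≡b = at-right k≡b
  ... | no k≢a  | no k≢b  = elsewhere k≢a k≢b

  transp-sym : (a b k : Fin n) → transp a b k ≡ transp b a k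
  transp-sym a b k with transpView a b k
  ... | at-left refl      = trans (transp-left k b) (sym (transp-right b k))
  ... | at-right refl     = trans (transp-right a k) (sym (transp-left k a))
  ... | elsewhere k≢a k≢b = trans (transp-other k≢a k≢b) (sym (transp-other k≢b k≢a))

  transp-involutive : (a b k : Fin n) → transp a b (transp a b k) ≡ k
  transp-involutive a b k with transpView a b k
  ... | at-left refl      = trans (cong (transp k b) (transp-left k b)) (transp-right k b)
  ... | at-right refl     = trans (cong (transp a k) (transp-right a k)) (transp-left a k)
  ... | elsewhere k≢a k≢b =
    trans (cong (transp a b) (transp-other k≢a k≢b)) (transp-other k≢a k≢b)

  transp-injective : (a b : Fin n) {k m : Fin n} → transp a b k ≡ transp a b m → k ≡ m
  transp-injective a b {k} {m} eq = begin
    k                            ≡⟨ transp-involutive a b k ⟨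
    transp a b (transp a b k)    ≡⟨ cong (transp a b) eq ⟩
    transp a b (transp a b m)    ≡⟨ transp-involutive a b m ⟩
    m                            ∎
    where open ≡-Reasoning

  transp-inverse : (a b k m : Fin n) → transp a b k ≡ m → k ≡ transp a b m
  transp-inverse a b k m eq = trans (sym (transp-involutive a b k)) (cong (transp a b) eq)

  transp-determined : (r s x y : Fin n) → transp r s x ≡ y → x ≢ y →
                      ∀ m → transp r s m ≡ transp x y m
  transp-determined r s x y eq x≢y m with transpView r s x
  ... | at-left refl  = cong (λ z → transp r z m) (trans (sym (transp-left r s)) eq)
  ... | at-right refl = trans (transp-sym r s m)
                              (cong (λ z → transp s z m) (trans (sym (transp-right r s)) eq))
  ... | elsewhere x≢r x≢s = contradiction (trans (sym (transp-other x≢r x≢s)) eq) x≢y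

  transp-comm : (i j k l m : Fin n) → k ≢ i → k ≢ j → l ≢ i → l ≢ j →
                transp i j (transp k l m) ≡ transp k l (transp i j m)
  transp-comm i j k l m k≢i k≢j l≢i l≢j with transpView k l m
  ... | at-left refl = begin
    transp i j (transp m l m)  ≡⟨ cong (transp i j) (transp-left m l) ⟩
    transp i j l               ≡⟨ transp-other l≢i l≢j ⟩
    l                          ≡⟨ transp-left m l ⟨
    transp m l m               ≡⟨ cong (transp m l) (transp-other k≢i k≢j) ⟨
    transp m l (transp i j m)  ∎
    where open ≡-Reasoning
  ... | at-right refl = begin
    transp i j (transp k m m)  ≡⟨ cong (transp i j) (transp-right k m) ⟩
    transp i j k               ≡⟨ transp-other k≢i k≢j ⟩
    k                          ≡⟨ transp-right k m ⟨
    transp k m m               ≡⟨ cong (transp k m) (transp-other l≢i l≢j) ⟨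
    transp k m (transp i j m)  ∎
    where open ≡-Reasoning
  ... | elsewhere m≢k m≢l =
    trans (cong (transp i j) (transp-other m≢k m≢l))
          (sym (transp-other (avoid k≢i k≢j m≢k) (avoid l≢i l≢j m≢l)))
    where
    avoid : ∀ {z} → z ≢ i → z ≢ j → m ≢ z → transp i j m ≢ z
    avoid {z} z≢i z≢j m≢z with transpView i j m
    ... | at-left refl      = λ eq → z≢j (trans (sym eq) (transp-left m j))
    ... | at-right refl     = λ eq → z≢i (trans (sym eq) (transp-right i m))
    ... | elsewhere m≢i m≢j = λ eq → m≢z (trans (sym (transp-other m≢i m≢j)) eq)

  swap : Perm n → Fin n → Fin n → Perm n
  swap x i j = tabulate (lookup x ∘ transp i j)

  lookup-swap : (x : Perm n) (i j k : Fin n) → lookup (swap x i j) k ≡ lookup x (transp i j k)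
  lookup-swap x i j = lookup∘tabulate (lookup x ∘ transp i j)

  swap-sym : (x : Perm n) (i j : Fin n) → swap x i j ≡ swap x j i
  swap-sym x i j = tabulate-cong (cong (lookup x) ∘ transp-sym i j)

  swap-involutive : (x : Perm n) (i j : Fin n) → swap (swap x i j) i j ≡ x
  swap-involutive x i j = vec-ext λ k →
    trans (lookup-swap (swap x i j) i j k)
          (trans (lookup-swap x i j (transp i j k)) (cong (lookup x) (transp-involutive i j k)))

  IsPerm-swap : (x : Perm n) (i j : Fin n) → IsPerm x → IsPerm (swap x i j)
  IsPerm-swap x i j x-perm p q eq = transp-injective i j
    (x-perm _ _ (trans (sym (lookup-swap x i j p)) (trans eq (lookup-swap x i j q))))

  IsPerm-transp∘ₚ : (x : Perm n) (α β : Fin n) → IsPerm x → IsPerm (transp α β ∘ₚ x)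
  IsPerm-transp∘ₚ x α β x-perm p q eq = x-perm p q (transp-injective α β
    (trans (sym (lookup∘tabulate _ p)) (trans eq (lookup∘tabulate _ q))))

  transp∘ₚ≡swap : (x : Perm n) → IsPerm x → ∀ {α β i j} → lookup x i ≡ α → lookup x j ≡ β →
                  transp α β ∘ₚ x ≡ swap x i j
  transp∘ₚ≡swap x x-perm {α} {β} {i} {j} xi≡α xj≡β = vec-ext λ k →
    trans (lookup∘tabulate _ k) (trans (values k) (sym (lookup-swap x i j k)))
    where
    values : ∀ k → transp α β (lookup x k) ≡ lookup x (transp i j k)
    values k with transpView i j k
    ... | at-left refl = begin
      transp α β (lookup x k)   ≡⟨ cong (transp α β) xi≡α ⟩
      transp α β α              ≡⟨ transp-left α β ⟩
      β                         ≡⟨ xj≡β ⟨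
      lookup x j                ≡⟨ cong (lookup x) (transp-left k j) ⟨
      lookup x (transp k j k)   ∎
      where open ≡-Reasoning
    ... | at-right refl = begin
      transp α β (lookup x k)   ≡⟨ cong (transp α β) xj≡β ⟩
      transp α β β              ≡⟨ transp-right α β ⟩
      α                         ≡⟨ xi≡α ⟨
      lookup x i                ≡⟨ cong (lookup x) (transp-right i k) ⟨
      lookup x (transp i k k)   ∎
      where open ≡-Reasoning
    ... | elsewhere k≢i k≢j =
      trans (transp-other (λ eq → k≢i (x-perm k i (trans eq (sym xi≡α))))
                          (λ eq → k≢j (x-perm k j (trans eq (sym xj≡β)))))
            (cong (lookup x) (sym (transp-other k≢i k≢j)))

-- Counting inversions

indicator : ∀ {P : Set} → Dec P → ℕ
indicator (yes _) = 1
indicator (no _)  = 0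

indicator-mono : ∀ {P Q : Set} (p : Dec P) (q : Dec Q) → (P → Q) → indicator p ℕ.≤ indicator q
indicator-mono (no _)  _       _   = z≤n
indicator-mono (yes _) (yes _) _   = ≤-refl
indicator-mono (yes p) (no ¬q) P⇒Q = contradiction (P⇒Q p) ¬q

indicator-strict : ∀ {P Q : Set} (p : Dec P) (q : Dec Q) → ¬ P → Q → indicator p ℕ.< indicator q
indicator-strict (no _)  (yes _) _  _  = ≤-refl
indicator-strict (yes p) _       ¬p _  = contradiction p ¬p
indicator-strict _       (no ¬q) _  q  = contradiction q ¬q

sum-mono : ∀ {m} (f g : Fin m → ℕ) → (∀ k → f k ℕ.≤ g k) → sum f ℕ.≤ sum g
sum-mono {zero}  f g f≤g = z≤n
sum-mono {suc m} f g f≤g = +-mono-≤ (f≤g Fin.zero) (sum-mono (f ∘ Fin.suc) (g ∘ Fin.suc) (f≤g ∘ Fin.suc))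

sum-strict : ∀ {m} (f g : Fin m → ℕ) → (∀ k → f k ℕ.≤ g k) → ∀ i → f i ℕ.< g i → sum f ℕ.< sum g
sum-strict {suc m} f g f≤g Fin.zero    fi<gi =
  +-mono-<-≤ fi<gi (sum-mono (f ∘ Fin.suc) (g ∘ Fin.suc) (f≤g ∘ Fin.suc))
sum-strict {suc m} f g f≤g (Fin.suc i) fi<gi =
  +-mono-≤-< (f≤g Fin.zero) (sum-strict (f ∘ Fin.suc) (g ∘ Fin.suc) (f≤g ∘ Fin.suc) i fi<gi)

length-filter-tabulate : ∀ {A : Set} {P : Pred A 0ℓ} (P? : Decidable P) {m} (f : Fin m → A) →
  length (filter P? (List.tabulate f)) ≡ sum (λ k → indicator (P? (f k)))
length-filter-tabulate P? {zero}  f = refl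
length-filter-tabulate P? {suc m} f with P? (f Fin.zero)
... | yes _ = cong suc (length-filter-tabulate P? (f ∘ Fin.suc))
... | no _  = length-filter-tabulate P? (f ∘ Fin.suc)

length-filter-cartesianProduct : ∀ {A B : Set} {P : Pred (A × B) 0ℓ} (P? : Decidable P)
  {l m} (f : Fin l → A) (g : Fin m → B) →
  length (filter P? (cartesianProduct (List.tabulate f) (List.tabulate g))) ≡
  sum (λ p → sum (λ q → indicator (P? (f p , g q))))
length-filter-cartesianProduct P? {zero}  f g = refl
length-filter-cartesianProduct {A} {B} P? {suc l} f g = begin
  length (filter P? (row ++ rest))                    ≡⟨ cong length (filter-++ P? row rest) ⟩
  length (filter P? row ++ filter P? rest)            ≡⟨ length-++ (filter P? row) ⟩
  length (filter P? row) + length (filter P? rest)    ≡⟨ cong₂ _+_ first-row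
                                                           (length-filter-cartesianProduct P? (f ∘ Fin.suc) g) ⟩
  _                                                   ∎
  where
  open ≡-Reasoning
  row rest : List (A × B)
  row  = List.map (f Fin.zero ,_) (List.tabulate g)
  rest = cartesianProduct (List.tabulate (f ∘ Fin.suc)) (List.tabulate g)
  first-row : length (filter P? row) ≡ sum (λ q → indicator (P? (f Fin.zero , g q)))
  first-row = trans (cong (length ∘ filter P?) (map-tabulate g (f Fin.zero ,_)))
                    (length-filter-tabulate P? (λ q → f Fin.zero , g q))

module _ {n : ℕ} where

  Inversion : Perm n → Fin n × Fin n → Set
  Inversion x (p , q) = p < q × lookup x q < lookup x p

  inversion? : (x : Perm n) → Decidable (Inversion x)
  inversion? x (p , q) = (p <? q) ×-dec (lookup x q <? lookup x p)

  isInversion : Perm n → Fin n → Fin n → ℕ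
  isInversion x p q = indicator (inversion? x (p , q))

  ℓ≡∑∑ : (x : Perm n) → ℓ x ≡ sum (λ p → sum (λ q → isInversion x p q))
  ℓ≡∑∑ x = length-filter-cartesianProduct (inversion? x) id id

-- With τ k the identity for i ≤ k ≤ j and the transposition (i j) otherwise,
-- (p , q) ↦ (τ q p , τ p q) is a bijection of pairs mapping the inversions of x to
-- inversions of swap x i j, and also the non-inversion (i , j) of x to one.
module SwapAscent {n} (x : Perm n) {i j : Fin n} (i<j : i < j) (xi<xj : lookup x i < lookup x j) where

  y : Perm n
  y = swap x i j

  Between : Fin n → Set
  Between k = i Fin.≤ k × k Fin.≤ j

  between? : ∀ k → Dec (Between k)
  between? k = (i ≤? k) ×-dec (k ≤? j)

  τ : Fin n → Fin n → Fin n
  τ k = if does (between? k) then id else transp i j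

  τ-permutation : Fin n → Permutation n n
  τ-permutation k = if does (between? k) then Permutation.id else Permutation.transpose i j

  τ-permutation-correct : ∀ k m → τ-permutation k ⟨$⟩ʳ m ≡ τ k m
  τ-permutation-correct k m with does (between? k)
  ... | true  = refl
  ... | false = transpose≡transp m
    where
    transpose≡transp : ∀ m → PermutationComponents.transpose i j m ≡ transp i j m
    transpose≡transp m with m Fin.≟ i
    ... | yes _ = refl
    ... | no _ with m Fin.≟ j
    ...   | yes _ = refl
    ...   | no _  = refl

  between-i : Between i
  between-i = ≤-refl , <⇒≤ i<j

  between-j : Between j
  between-j = <⇒≤ i<j , ≤-refl

  between-transp : ∀ k → does (between? (transp i j k)) ≡ does (between? k)
  between-transp k with transpView i j k
  ... | at-left refl = begin
    does (between? (transp k j k))  ≡⟨ cong (does ∘ between?) (transp-left k j) ⟩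
    does (between? j)               ≡⟨ dec-true (between? j) between-j ⟩
    true                            ≡⟨ dec-true (between? k) between-i ⟨
    does (between? k)               ∎
    where open ≡-Reasoning
  ... | at-right refl = begin
    does (between? (transp i k k))  ≡⟨ cong (does ∘ between?) (transp-right i k) ⟩
    does (between? i)               ≡⟨ dec-true (between? i) between-i ⟩
    true                            ≡⟨ dec-true (between? k) between-j ⟨
    does (between? k)               ∎
    where open ≡-Reasoning
  ... | elsewhere k≢i k≢j = cong (does ∘ between?) (transp-other k≢i k≢j)

  between-τ : ∀ q p → does (between? (τ q p)) ≡ does (between? p)
  between-τ q p with does (between? q)
  ... | true  = refl
  ... | false = between-transp p

  τ-outside : ∀ k {m} → m ≢ i → m ≢ j → τ k m ≡ m
  τ-outside k m≢i m≢j with does (between? k)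
  ... | true  = refl
  ... | false = transp-other m≢i m≢j

  τ-between : ∀ {k} m → Between k → τ k m ≡ m
  τ-between {k} m b rewrite dec-true (between? k) b = refl

  τ-not-between : ∀ {k} m → ¬ Between k → τ k m ≡ transp i j m
  τ-not-between {k} m ¬b rewrite dec-false (between? k) ¬b = refl

  inversion-after : ∀ {p q P Q} → τ q p ≡ P → τ p q ≡ Q → P < Q →
                    lookup x (transp i j Q) < lookup x (transp i j P) → Inversion y (τ q p , τ p q)
  inversion-after refl refl P<Q x<x =
    P<Q , subst₂ _<_ (sym (lookup-swap x i j _)) (sym (lookup-swap x i j _)) x<x

  x-at : ∀ {a b} → a ≡ b → lookup x a ≡ lookup x b
  x-at = cong (lookup x)

  <-resp : ∀ {a b c d : Fin n} → a ≡ c → b ≡ d → c < d → a < b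
  <-resp refl refl c<d = c<d

  inversion-transfer : ∀ p q → Inversion x (p , q) → Inversion y (τ q p , τ p q)
  inversion-transfer p q (p<q , xq<xp) with transpView i j p | transpView i j q
  ... | at-left refl | at-left refl = contradiction p<q (<-irrefl refl)
  ... | at-left refl | at-right refl = contradiction xi<xj (<-asym xq<xp)
  ... | at-left refl | elsewhere q≢i q≢j with between? q
  ...   | yes q-between = inversion-after (τ-between p q-between) (τ-between q between-i) p<q
          (<-resp (x-at (transp-other q≢i q≢j)) (x-at (transp-left p j)) (<-trans xq<xp xi<xj))
  ...   | no ¬q-between = inversion-after (trans (τ-not-between p ¬q-between) (transp-left p j))
          (τ-between q between-i) j<q
          (<-resp (x-at (transp-other q≢i q≢j)) (x-at (transp-right p j)) xq<xp)
    where
    j<q : j < q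
    j<q = ≤∧≢⇒< (≮⇒≥ λ q<j → ¬q-between (<⇒≤ p<q , <⇒≤ q<j)) (λ j≡q → q≢j (sym j≡q))
  inversion-transfer p q (p<q , xq<xp) | at-right refl | at-left refl = contradiction i<j (<-asym p<q)
  inversion-transfer p q (p<q , xq<xp) | at-right refl | at-right refl = contradiction p<q (<-irrefl refl)
  inversion-transfer p q (p<q , xq<xp) | at-right refl | elsewhere q≢i q≢j with between? q
  ... | yes (_ , q≤p) = contradiction q≤p (<⇒≱ p<q)
  ... | no ¬q-between = inversion-after (trans (τ-not-between p ¬q-between) (transp-right i p))
          (τ-between q between-j) (<-trans i<j p<q)
          (<-resp (x-at (transp-other q≢i q≢j)) (x-at (transp-left i p)) xq<xp)
  inversion-transfer p q (p<q , xq<xp) | elsewhere p≢i p≢j | at-left refl with between? p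
  ... | yes (q≤p , _) = contradiction q≤p (<⇒≱ p<q)
  ... | no ¬p-between = inversion-after (τ-between p between-i)
          (trans (τ-not-between q ¬p-between) (transp-left q j)) (<-trans p<q i<j)
          (<-resp (x-at (transp-right q j)) (x-at (transp-other p≢i p≢j)) xq<xp)
  inversion-transfer p q (p<q , xq<xp) | elsewhere p≢i p≢j | at-right refl with between? p
  ... | yes p-between = inversion-after (τ-between p between-j) (τ-between q p-between) p<q
          (<-resp (x-at (transp-right i q)) (x-at (transp-other p≢i p≢j)) (<-trans xi<xj xq<xp))
  ... | no ¬p-between = inversion-after (τ-between p between-j)
          (trans (τ-not-between q ¬p-between) (transp-right i q)) p<i
          (<-resp (x-at (transp-left i q)) (x-at (transp-other p≢i p≢j)) xq<xp)
    where
    p<i : p < i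
    p<i = ≤∧≢⇒< (≮⇒≥ λ i<p → ¬p-between (<⇒≤ i<p , <⇒≤ p<q)) p≢i
  inversion-transfer p q (p<q , xq<xp) | elsewhere p≢i p≢j | elsewhere q≢i q≢j =
    inversion-after (τ-outside q p≢i p≢j) (τ-outside p q≢i q≢j) p<q
      (<-resp (x-at (transp-other q≢i q≢j)) (x-at (transp-other p≢i p≢j)) xq<xp)

  new-inversion : Inversion y (τ j i , τ i j)
  new-inversion = inversion-after (τ-between i between-j) (τ-between j between-i) i<j
    (<-resp (x-at (transp-right i j)) (x-at (transp-left i j)) xi<xj)

  ℓ-reindexed : ℓ y ≡ sum (λ q → sum (λ p → isInversion y (τ q p) (τ p q)))
  ℓ-reindexed = begin
    ℓ y                                                      ≡⟨ ℓ≡∑∑ y ⟩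
    sum (λ p → sum (λ q → isInversion y p q))                ≡⟨ sum-cong-≗ reindex-q ⟩
    sum (λ p → sum (λ q → isInversion y p (τ p q)))          ≡⟨ ∑-comm (λ p q → isInversion y p (τ p q)) ⟩
    sum (λ q → sum (λ p → isInversion y p (τ p q)))          ≡⟨ sum-cong-≗ reindex-p ⟩
    sum (λ q → sum (λ p → isInversion y (τ q p) (τ p q)))    ∎
    where
    open ≡-Reasoning
    reindex-q : ∀ p → sum (isInversion y p) ≡ sum (λ q → isInversion y p (τ p q))
    reindex-q p = trans (∑-permute (isInversion y p) (τ-permutation p))
                        (sum-cong-≗ (cong (isInversion y p) ∘ τ-permutation-correct p))
    -- τ (τ q p) = τ p, since τ k only depends on whether k lies between i and j
    reindex-p : ∀ q → sum (λ p → isInversion y p (τ p q)) ≡ sum (λ p → isInversion y (τ q p) (τ p q))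
    reindex-p q = trans (∑-permute (λ p → isInversion y p (τ p q)) (τ-permutation q))
      (sum-cong-≗ λ p → trans (cong (λ k → isInversion y k (τ k q)) (τ-permutation-correct q p))
        (cong (isInversion y (τ q p)) (cong (λ b → (if b then id else transp i j) q) (between-τ q p))))

  ℓ-increases : ℓ x ℕ.< ℓ y
  ℓ-increases = subst₂ ℕ._<_ (sym (trans (ℓ≡∑∑ x) (∑-comm (isInversion x)))) (sym ℓ-reindexed)
    (sum-strict _ _ (λ q → sum-mono _ _ (λ p → transferred p q)) j
      (sum-strict _ _ (λ p → transferred p j) i
        (indicator-strict (inversion? x (i , j)) (inversion? y _) (λ (_ , xj<xi) → <-asym xj<xi xi<xj) new-inversion)))
    where
    transferred : ∀ p q → isInversion x p q ℕ.≤ isInversion y (τ q p) (τ p q)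
    transferred p q = indicator-mono (inversion? x (p , q)) (inversion? y _) (inversion-transfer p q)

-- Bruhat edges as swaps of ascents

SameOrder : ℕ → ℕ → ℕ → ℕ → Set
SameOrder p q v w = (p ℕ.< q × v ℕ.< w) ⊎ (q ℕ.< p × w ℕ.< v)

module _ {n : ℕ} where

  data Ascent (x : Perm n) (p q : Fin n) : Set where
    increasing : p < q → lookup x p < lookup x q → Ascent x p q
    decreasing : q < p → lookup x q < lookup x p → Ascent x p q

  Ascent-sym : ∀ {x p q} → Ascent x p q → Ascent x q p
  Ascent-sym (increasing p<q xp<xq) = decreasing p<q xp<xq
  Ascent-sym (decreasing q<p xq<xp) = increasing q<p xq<xp

  Ascent⇒SameOrder : ∀ {x p q} → Ascent x p q →
                     SameOrder (toℕ p) (toℕ q) (toℕ (lookup x p)) (toℕ (lookup x q))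
  Ascent⇒SameOrder (increasing p<q xp<xq) = inj₁ (p<q , xp<xq)
  Ascent⇒SameOrder (decreasing q<p xq<xp) = inj₂ (q<p , xq<xp)

  SameOrder⇒Ascent : ∀ {x p q} → SameOrder (toℕ p) (toℕ q) (toℕ (lookup x p)) (toℕ (lookup x q)) →
                     Ascent x p q
  SameOrder⇒Ascent (inj₁ (p<q , xp<xq)) = increasing p<q xp<xq
  SameOrder⇒Ascent (inj₂ (q<p , xq<xp)) = decreasing q<p xq<xp

  Ascent-values : ∀ {x x' p q} → lookup x p ≡ lookup x' p → lookup x q ≡ lookup x' q →
                  Ascent x p q → Ascent x' p q
  Ascent-values xp≡x'p xq≡x'q (increasing p<q xp<xq) = increasing p<q (subst₂ _<_ xp≡x'p xq≡x'q xp<xq)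
  Ascent-values xp≡x'p xq≡x'q (decreasing q<p xq<xp) = decreasing q<p (subst₂ _<_ xq≡x'q xp≡x'p xq<xp)

  swap-at-left : (x : Perm n) (i j : Fin n) → lookup (swap x i j) i ≡ lookup x j
  swap-at-left x i j = trans (lookup-swap x i j i) (cong (lookup x) (transp-left i j))

  swap-at-right : (x : Perm n) (i j : Fin n) → lookup (swap x i j) j ≡ lookup x i
  swap-at-right x i j = trans (lookup-swap x i j j) (cong (lookup x) (transp-right i j))

  swap-outside : (x : Perm n) {i j m : Fin n} → m ≢ i → m ≢ j → lookup (swap x i j) m ≡ lookup x m
  swap-outside x {i} {j} {m} m≢i m≢j = trans (lookup-swap x i j m) (cong (lookup x) (transp-other m≢i m≢j))

  ℓ-swap-ascent : ∀ {x p q} → Ascent x p q → ℓ x ℕ.< ℓ (swap x p q)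
  ℓ-swap-ascent {x} (increasing p<q xp<xq) = SwapAscent.ℓ-increases x p<q xp<xq
  ℓ-swap-ascent {x} {p} {q} (decreasing q<p xq<xp) =
    subst (λ y → ℓ x ℕ.< ℓ y) (swap-sym x q p) (SwapAscent.ℓ-increases x q<p xq<xp)

  ascent-or-swapped-ascent : ∀ x {p q} → IsPerm x → p ≢ q → Ascent x p q ⊎ Ascent (swap x p q) p q
  ascent-or-swapped-ascent x {p} {q} x-perm p≢q with Fin.<-cmp p q | Fin.<-cmp (lookup x p) (lookup x q)
  ... | tri≈ _ p≡q _ | _              = contradiction p≡q p≢q
  ... | _            | tri≈ _ xp≡xq _ = contradiction (x-perm p q xp≡xq) p≢q
  ... | tri< p<q _ _ | tri< xp<xq _ _ = inj₁ (increasing p<q xp<xq)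
  ... | tri> _ _ q<p | tri> _ _ xq<xp = inj₁ (decreasing q<p xq<xp)
  ... | tri< p<q _ _ | tri> _ _ xq<xp = inj₂ (increasing p<q
          (subst₂ _<_ (sym (swap-at-left x p q)) (sym (swap-at-right x p q)) xq<xp))
  ... | tri> _ _ q<p | tri< xp<xq _ _ = inj₂ (decreasing q<p
          (subst₂ _<_ (sym (swap-at-right x p q)) (sym (swap-at-left x p q)) xp<xq))

  ℓ-swap⇒ascent : ∀ x {p q} → IsPerm x → p ≢ q → ℓ x ℕ.< ℓ (swap x p q) → Ascent x p q
  ℓ-swap⇒ascent x {p} {q} x-perm p≢q ℓ< with ascent-or-swapped-ascent x x-perm p≢q
  ... | inj₁ ascent = ascent
  ... | inj₂ ascent = contradiction ℓ< (<-asym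
          (subst (λ z → ℓ (swap x p q) ℕ.< ℓ z) (swap-involutive x p q) (ℓ-swap-ascent ascent)))

  data AscentSwap (x : Perm n) : Perm n → Set where
    ascent-swap : ∀ {p q} → p ≢ q → Ascent x p q → AscentSwap x (swap x p q)

  AscentSwap⇒BEdge : ∀ {x y : Perm n} → IsPerm x → AscentSwap x y → BEdge x y
  AscentSwap⇒BEdge {x} x-perm (ascent-swap {p} {q} p≢q ascent) =
    (lookup x p , lookup x q , (λ xp≡xq → p≢q (x-perm p q xp≡xq)) ,
     sym (transp∘ₚ≡swap x x-perm refl refl)) ,
    ℓ-swap-ascent ascent

  Ascent⇒BEdge : ∀ {x : Perm n} {p q} → IsPerm x → p ≢ q → Ascent x p q → BEdge x (swap x p q)
  Ascent⇒BEdge x-perm p≢q ascent = AscentSwap⇒BEdge x-perm (ascent-swap p≢q ascent)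

  BEdge⇒AscentSwap : ∀ {x y : Perm n} → IsPerm x → BEdge x y → AscentSwap x y
  BEdge⇒AscentSwap {x} x-perm ((α , β , α≢β , refl) , ℓ<)
    with i , xi≡α ← IsPerm⇒surjective x x-perm α
       | j , xj≡β ← IsPerm⇒surjective x x-perm β
    rewrite transp∘ₚ≡swap x x-perm xi≡α xj≡β =
    ascent-swap i≢j (ℓ-swap⇒ascent x x-perm i≢j ℓ<)
    where
    i≢j : i ≢ j
    i≢j i≡j = α≢β (trans (sym xi≡α) (trans (cong (lookup x) i≡j) xj≡β))

  IsPerm-BEdge : ∀ {x y : Perm n} → IsPerm x → BEdge x y → IsPerm y
  IsPerm-BEdge {x} x-perm ((α , β , _ , refl) , _) = IsPerm-transp∘ₚ x α β x-perm

-- Order patterns on three points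

Xor : Set → Set → Set
Xor P Q = (P × ¬ Q) ⊎ (¬ P × Q)

Xor-map : ∀ {P P' Q Q'} → P ⇔ P' → Q ⇔ Q' → Xor P Q → Xor P' Q'
Xor-map P⇔P' Q⇔Q' = Sum.map (Product.map (to P⇔P') (_∘ from Q⇔Q')) (Product.map (_∘ from P⇔P') (to Q⇔Q'))
  where open Equivalence

Xor-from-Dec : ∀ {P Q} (p : Dec P) (q : Dec Q) → T (does p xor does q) → Xor P Q
Xor-from-Dec (yes p) (no ¬q) _ = inj₁ (p , ¬q)
Xor-from-Dec (no ¬p) (yes q) _ = inj₂ (¬p , q)

sign : ℕ → ℕ → Bool
sign p q = p <ᵇ q

sign-< : ∀ {p q} → p ℕ.< q → sign p q ≡ true
sign-< p<q = Equivalence.to T-≡ (<⇒<ᵇ p<q)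

sign-> : ∀ {p q} → q ℕ.< p → sign p q ≡ false
sign-> {p} {q} q<p with sign p q in eq
... | true  = contradiction (<ᵇ⇒< p q (subst T (sym eq) _)) (<-asym q<p)
... | false = refl

data SignView (p q : ℕ) : Set where
  ascending  : p ℕ.< q → sign p q ≡ true  → SignView p q
  descending : q ℕ.< p → sign p q ≡ false → SignView p q

signView : ∀ {p q} → p ≢ q → SignView p q
signView {p} {q} p≢q with ℕ.<-cmp p q
... | tri< p<q _ _ = ascending p<q (sign-< p<q)
... | tri≈ _ p≡q _ = contradiction p≡q p≢q
... | tri> _ _ q<p = descending q<p (sign-> q<p)

sign-flip : ∀ {p q} → p ≢ q → sign q p ≡ not (sign p q)
sign-flip {p} {q} p≢q with signView p≢q | signView (p≢q ∘ sym)
... | ascending p<q _   | ascending q<p _   = contradiction q<p (<-asym p<q)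
... | ascending _ s≡t   | descending _ s'≡f = trans s'≡f (cong not (sym s≡t))
... | descending _ s≡f  | ascending _ s'≡t  = trans s'≡t (cong not (sym s≡f))
... | descending q<p _  | descending p<q _  = contradiction q<p (<-asym p<q)

sign≡⇔SameOrder : ∀ {p q v w} → p ≢ q → v ≢ w → (sign p q ≡ sign v w) ⇔ SameOrder p q v w
sign≡⇔SameOrder p≢q v≢w = mk⇔ (from (signView p≢q) (signView v≢w)) (to (signView p≢q) (signView v≢w))
  where
  to : ∀ {p q v w} → SignView p q → SignView v w → SameOrder p q v w → sign p q ≡ sign v w
  to (ascending _ s≡t)    (ascending _ s'≡t)  _                   = trans s≡t (sym s'≡t)
  to (descending _ s≡f)   (descending _ s'≡f) _                   = trans s≡f (sym s'≡f)
  to (ascending p<q _)    (descending _ _)    (inj₂ (q<p , _))    = contradiction q<p (<-asym p<q)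
  to (ascending _ _)      (descending w<v _)  (inj₁ (_ , v<w))    = contradiction w<v (<-asym v<w)
  to (descending q<p _)   (ascending _ _)     (inj₁ (p<q , _))    = contradiction q<p (<-asym p<q)
  to (descending _ _)     (ascending v<w _)   (inj₂ (_ , w<v))    = contradiction w<v (<-asym v<w)
  from : ∀ {p q v w} → SignView p q → SignView v w → sign p q ≡ sign v w → SameOrder p q v w
  from (ascending p<q _)  (ascending v<w _)   _ = inj₁ (p<q , v<w)
  from (descending q<p _) (descending w<v _)  _ = inj₂ (q<p , w<v)
  from (ascending _ s≡t)  (descending _ s'≡f) eq = contradiction (trans (sym s≡t) (trans eq s'≡f)) λ ()
  from (descending _ s≡f) (ascending _ s'≡t)  eq = contradiction (trans (sym s'≡t) (trans (sym eq) s≡f)) λ ()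

-- the possible signs of (a , b), (b , c) and (a , c) for distinct a, b, c
data Consistent : Bool → Bool → Bool → Set where
  monotone : ∀ {s} → Consistent s s s
  turning  : ∀ {s u} → Consistent s (not s) u

sign-consistent : ∀ {a b c} → a ≢ b → b ≢ c → Consistent (sign a b) (sign b c) (sign a c)
sign-consistent a≢b b≢c with signView a≢b | signView b≢c
... | ascending a<b ab  | ascending b<c bc  rewrite ab | bc | sign-< (<-trans a<b b<c) = monotone
... | descending b<a ab | descending c<b bc rewrite ab | bc | sign-> (<-trans c<b b<a) = monotone
... | ascending _ ab    | descending _ bc   rewrite ab | bc = turning
... | descending _ ab   | ascending _ bc    rewrite ab | bc = turning

sign-pattern : ∀ {s₁ s₂ s₃ t} → Consistent s₁ s₂ s₃ → Consistent s₁ t s₂ →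
               Xor (s₂ ≡ t × s₃ ≡ s₁) (s₃ ≡ s₂ × not s₁ ≡ t)
sign-pattern c₁ c₂ = Xor-from-Dec ((_ Bool.≟ _) ×-dec (_ Bool.≟ _)) ((_ Bool.≟ _) ×-dec (_ Bool.≟ _)) (by-cases c₁ c₂)
  where
  by-cases : ∀ {s₁ s₂ s₃ t} → Consistent s₁ s₂ s₃ → Consistent s₁ t s₂ →
             T (does ((s₂ Bool.≟ t) ×-dec (s₃ Bool.≟ s₁)) xor does ((s₃ Bool.≟ s₂) ×-dec (not s₁ Bool.≟ t)))
  by-cases {true}             monotone monotone = _
  by-cases {false}            monotone monotone = _
  by-cases {true}             monotone turning  = _
  by-cases {false}            monotone turning  = _
  by-cases {true}  {s₃ = true}  turning turning = _
  by-cases {true}  {s₃ = false} turning turning = _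
  by-cases {false} {s₃ = true}  turning turning = _
  by-cases {false} {s₃ = false} turning turning = _

-- I, J, K are positions of a permutation a carrying the values A, B, C.  If
-- a → a (I J) → a (I J) (J K) is a path in the Bruhat graph, then exactly one of
-- a → a (J K) → a (J K) (K I) and a → a (K I) → a (K I) (I J) is one as well.
three-point-pattern : ∀ {I J K A B C} → I ≢ J → J ≢ K → I ≢ K → A ≢ B → B ≢ C → A ≢ C →
  SameOrder I J A B → SameOrder J K A C →
  Xor (SameOrder J K B C × SameOrder I K A B) (SameOrder I K A C × SameOrder J I B C)
three-point-pattern {I} {J} {K} {A} {B} {C} I≢J J≢K I≢K A≢B B≢C A≢C ij∼ab jk∼ac =
  Xor-map (sign≡⇔SameOrder J≢K B≢C ×-⇔ ik∼ab) (ik∼ac ×-⇔ ji∼bc)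
    (sign-pattern (sign-consistent I≢J J≢K) values)
  where
  ij≡ab : sign I J ≡ sign A B
  ij≡ab = Equivalence.from (sign≡⇔SameOrder I≢J A≢B) ij∼ab
  jk≡ac : sign J K ≡ sign A C
  jk≡ac = Equivalence.from (sign≡⇔SameOrder J≢K A≢C) jk∼ac
  values : Consistent (sign I J) (sign B C) (sign J K)
  values = subst₂ (λ x y → Consistent x (sign B C) y) (sym ij≡ab) (sym jk≡ac) (sign-consistent A≢B B≢C)
  ik∼ab : (sign I K ≡ sign I J) ⇔ SameOrder I K A B
  ik∼ab = subst (λ x → (sign I K ≡ x) ⇔ SameOrder I K A B) (sym ij≡ab) (sign≡⇔SameOrder I≢K A≢B)
  ik∼ac : (sign I K ≡ sign J K) ⇔ SameOrder I K A C
  ik∼ac = subst (λ x → (sign I K ≡ x) ⇔ SameOrder I K A C) (sym jk≡ac) (sign≡⇔SameOrder I≢K A≢C)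
  ji∼bc : (not (sign I J) ≡ sign B C) ⇔ SameOrder J I B C
  ji∼bc = subst (λ x → (x ≡ sign B C) ⇔ SameOrder J I B C) (sign-flip I≢J) (sign≡⇔SameOrder (I≢J ∘ sym) B≢C)

-- Paths of length two in the Bruhat graph

module _ {n : ℕ} where

  record OtherMiddle (a c b : Perm n) : Set where
    field
      c'   : Perm n
      c'≢c : c' ≢ c
      a→c' : BEdge a c'
      c'→b : BEdge c' b
      only : ∀ {d} → BEdge a d → BEdge d b → d ≡ c ⊎ d ≡ c'

  lookup-swap² : (a : Perm n) (i j k l m : Fin n) →
                 lookup (swap (swap a i j) k l) m ≡ lookup a (transp i j (transp k l m))
  lookup-swap² a i j k l m = trans (lookup-swap (swap a i j) k l m) (lookup-swap a i j (transp k l m))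

  swap²-cong : (a : Perm n) {i j k l i' j' k' l' : Fin n} →
               (∀ m → transp i j (transp k l m) ≡ transp i' j' (transp k' l' m)) →
               swap (swap a i j) k l ≡ swap (swap a i' j') k' l'
  swap²-cong a {i} {j} {k} {l} {i'} {j'} {k'} {l'} eq = vec-ext λ m →
    trans (lookup-swap² a i j k l m) (trans (cong (lookup a) (eq m)) (sym (lookup-swap² a i' j' k' l' m)))

  transp²-fixes : ∀ {i j k l m : Fin n} → m ≢ i → m ≢ j → m ≢ k → m ≢ l → transp i j (transp k l m) ≡ m
  transp²-fixes m≢i m≢j m≢k m≢l = trans (cong (transp _ _) (transp-other m≢k m≢l)) (transp-other m≢i m≢j)

  BEdge-swap⇔Ascent : ∀ {x : Perm n} {p q} → IsPerm x → p ≢ q → BEdge x (swap x p q) ⇔ Ascent x p q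
  BEdge-swap⇔Ascent {x} x-perm p≢q =
    mk⇔ (ℓ-swap⇒ascent x x-perm p≢q ∘ proj₂) (AscentSwap⇒BEdge x-perm ∘ ascent-swap p≢q)

  Ascent⇔SameOrder : ∀ {x : Perm n} {p q v w} → lookup x p ≡ v → lookup x q ≡ w →
                     Ascent x p q ⇔ SameOrder (toℕ p) (toℕ q) (toℕ v) (toℕ w)
  Ascent⇔SameOrder refl refl = mk⇔ Ascent⇒SameOrder SameOrder⇒Ascent

  Ascent-sym⇔ : ∀ {x : Perm n} {p q} → Ascent x p q ⇔ Ascent x q p
  Ascent-sym⇔ = mk⇔ Ascent-sym Ascent-sym

  module Factorisation {p q r s : Fin n} {g : Fin n → Fin n}
                       (factor : ∀ m → transp p q (transp r s m) ≡ g m) (p≢q : p ≢ q) where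

    trivial : (∀ m → transp r s m ≡ transp p q m) → ∀ m → g m ≡ m
    trivial rs≗pq m = trans (sym (factor m)) (trans (cong (transp p q) (rs≗pq m)) (transp-involutive p q m))

    moves-p : ∀ {w} → g w ≢ w → g p ≢ p
    moves-p gw≢w gp≡p = gw≢w (trivial (transp-determined r s p q rs-p≡q p≢q) _)
      where
      rs-p≡q : transp r s p ≡ q
      rs-p≡q = trans (transp-inverse p q _ p (trans (factor p) gp≡p)) (transp-left p q)

    moves-q : ∀ {w} → g w ≢ w → g q ≢ q
    moves-q gw≢w gq≡q = gw≢w (trivial (λ m → trans (transp-determined r s q p rs-q≡p (p≢q ∘ sym) m)
                                                    (transp-sym q p m)) _)
      where
      rs-q≡p : transp r s q ≡ p
      rs-q≡p = trans (transp-inverse p q _ q (trans (factor q) gq≡q)) (transp-right p q)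

    -- If g p lies outside {p, q}, then (r s) = (p (g p)) fixes q.
    partner : g p ≢ p → g p ≢ q → g q ≡ p
    partner gp≢p gp≢q = begin
      g q                            ≡⟨ factor q ⟨
      transp p q (transp r s q)      ≡⟨ cong (transp p q) (transp-determined r s p (g p) rs-p≡gp (gp≢p ∘ sym) q) ⟩
      transp p q (transp p (g p) q)  ≡⟨ cong (transp p q) (transp-other (p≢q ∘ sym) (gp≢q ∘ sym)) ⟩
      transp p q q                   ≡⟨ transp-right p q ⟩
      p                              ∎
      where
      open ≡-Reasoning
      rs-p≡gp : transp r s p ≡ g p
      rs-p≡gp = trans (transp-inverse p q _ (g p) (factor p)) (transp-other gp≢p gp≢q)

    partner-of-involution : (∀ m → g (g m) ≡ m) → g p ≢ p → g p ≡ q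
    partner-of-involution g-involutive gp≢p with g p ≟ q
    ... | yes gp≡q = gp≡q
    ... | no gp≢q  = trans (cong g (sym (partner gp≢p gp≢q))) (g-involutive q)

  middle-factors : (a : Perm n) → IsPerm a → ∀ {g : Fin n → Fin n} {d b : Perm n} →
    (∀ m → lookup b m ≡ lookup a (g m)) → BEdge a d → BEdge d b →
    Σ (Fin n) λ p → Σ (Fin n) λ q → p ≢ q × d ≡ swap a p q ×
      Σ (Fin n) λ r → Σ (Fin n) λ s → ∀ m → transp p q (transp r s m) ≡ g m
  middle-factors a a-perm b≗ag a→d d→b with BEdge⇒AscentSwap {x = a} a-perm a→d
  ... | ascent-swap {p} {q} p≢q _ with BEdge⇒AscentSwap {x = swap a p q} (IsPerm-swap a p q a-perm) d→b
  ...   | ascent-swap {r} {s} _ _ = p , q , p≢q , refl , r , s , λ m →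
          a-perm _ _ (trans (sym (lookup-swap² a p q r s m)) (b≗ag m))

module _ {n : ℕ} where

  module Disjoint {a : Perm n} (a-perm : IsPerm a) {i j k l : Fin n} (i≢j : i ≢ j) (k≢l : k ≢ l)
                  (k≢i : k ≢ i) (k≢j : k ≢ j) (l≢i : l ≢ i) (l≢j : l ≢ j)
                  (ij-ascent : Ascent a i j) (kl-ascent : Ascent (swap a i j) k l) where

    g : Fin n → Fin n
    g m = transp i j (transp k l m)

    g-i : g i ≡ j
    g-i = trans (cong (transp i j) (transp-other (k≢i ∘ sym) (l≢i ∘ sym))) (transp-left i j)

    g-j : g j ≡ i
    g-j = trans (cong (transp i j) (transp-other (k≢j ∘ sym) (l≢j ∘ sym))) (transp-right i j)

    g-k : g k ≡ l
    g-k = trans (cong (transp i j) (transp-left k l)) (transp-other l≢i l≢j)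

    g-l : g l ≡ k
    g-l = trans (cong (transp i j) (transp-right k l)) (transp-other k≢i k≢j)

    g-involutive : ∀ m → g (g m) ≡ m
    g-involutive m = begin
      transp i j (transp k l (transp i j (transp k l m)))   ≡⟨ cong (transp i j) (transp-comm i j k l (transp k l m) k≢i k≢j l≢i l≢j) ⟨
      transp i j (transp i j (transp k l (transp k l m)))   ≡⟨ transp-involutive i j _ ⟩
      transp k l (transp k l m)                             ≡⟨ transp-involutive k l m ⟩
      m                                                     ∎
      where open ≡-Reasoning

    c c' b : Perm n
    c  = swap a i j
    c' = swap a k l
    b  = swap c k l

    b≡swap-c' : b ≡ swap c' i j
    b≡swap-c' = swap²-cong a λ m → transp-comm i j k l m k≢i k≢j l≢i l≢j

    a→c' : BEdge a c'
    a→c' = Ascent⇒BEdge {x = a} a-perm k≢l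
      (Ascent-values (swap-outside a k≢i k≢j) (swap-outside a l≢i l≢j) kl-ascent)

    c'→b : BEdge c' b
    c'→b = subst (BEdge c') (sym b≡swap-c') (Ascent⇒BEdge {x = c'} (IsPerm-swap a k l a-perm) i≢j
      (Ascent-values (sym (swap-outside a (k≢i ∘ sym) (l≢i ∘ sym))) (sym (swap-outside a (k≢j ∘ sym) (l≢j ∘ sym)))
        ij-ascent))

    c'≢c : c' ≢ c
    c'≢c c'≡c = i≢j (a-perm i j (begin
      lookup a i    ≡⟨ swap-outside a (k≢i ∘ sym) (l≢i ∘ sym) ⟨
      lookup c' i   ≡⟨ cong (λ x → lookup x i) c'≡c ⟩
      lookup c i    ≡⟨ swap-at-left a i j ⟩
      lookup a j    ∎))
      where open ≡-Reasoning

    candidates : ∀ {p q} → g p ≡ q → g p ≢ p → swap a p q ≡ c ⊎ swap a p q ≡ c'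
    candidates {p} {q} gp≡q gp≢p = by-cases (p ≟ i) (p ≟ j) (p ≟ k) (p ≟ l)
      where
      q≡ : ∀ {x y} → p ≡ x → g x ≡ y → q ≡ y
      q≡ refl gx≡y = trans (sym gp≡q) gx≡y
      by-cases : Dec (p ≡ i) → Dec (p ≡ j) → Dec (p ≡ k) → Dec (p ≡ l) → swap a p q ≡ c ⊎ swap a p q ≡ c'
      by-cases (yes p≡i) _ _ _ = inj₁ (cong₂ (swap a) p≡i (q≡ p≡i g-i))
      by-cases _ (yes p≡j) _ _ = inj₁ (trans (cong₂ (swap a) p≡j (q≡ p≡j g-j)) (swap-sym a j i))
      by-cases _ _ (yes p≡k) _ = inj₂ (cong₂ (swap a) p≡k (q≡ p≡k g-k))
      by-cases _ _ _ (yes p≡l) = inj₂ (trans (cong₂ (swap a) p≡l (q≡ p≡l g-l)) (swap-sym a l k))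
      by-cases (no p≢i) (no p≢j) (no p≢k) (no p≢l) = contradiction (transp²-fixes p≢i p≢j p≢k p≢l) gp≢p

    -- g is an involution, so each of its factorisations (p q)(r s) has g p = q.
    only : ∀ {d} → BEdge a d → BEdge d b → d ≡ c ⊎ d ≡ c'
    only a→d d→b with middle-factors a a-perm (lookup-swap² a i j k l) a→d d→b
    ... | p , q , p≢q , refl , _ , _ , factor = candidates (partner-of-involution g-involutive gp≢p) gp≢p
      where
      open Factorisation factor p≢q
      gp≢p : g p ≢ p
      gp≢p = moves-p {w = i} (λ gi≡i → i≢j (trans (sym gi≡i) g-i))

    other-middle : OtherMiddle a c b
    other-middle = record { c' = c' ; c'≢c = c'≢c ; a→c' = a→c' ; c'→b = c'→b ; only = only }

module _ {n : ℕ} where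

  data Among₃ (x y z : Fin n) : Fin n → Set where
    is-x : Among₃ x y z x
    is-y : Among₃ x y z y
    is-z : Among₃ x y z z
    none : ∀ {m} → m ≢ x → m ≢ y → m ≢ z → Among₃ x y z m

  among₃ : ∀ x y z m → Among₃ x y z m
  among₃ x y z m with m ≟ x | m ≟ y | m ≟ z
  ... | yes refl | _        | _        = is-x
  ... | no _     | yes refl | _        = is-y
  ... | no _     | no _     | yes refl = is-z
  ... | no m≢x   | no m≢y   | no m≢z   = none m≢x m≢y m≢z

  transp-rotate : ∀ {x y z : Fin n} → x ≢ y → y ≢ z → x ≢ z →
                  ∀ m → transp x y (transp y z m) ≡ transp y z (transp z x m)
  transp-rotate {x} {y} {z} x≢y y≢z x≢z m with among₃ x y z m
  ... | is-x = begin
    transp x y (transp y z x)  ≡⟨ cong (transp x y) (transp-other x≢y x≢z) ⟩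
    transp x y x               ≡⟨ transp-left x y ⟩
    y                          ≡⟨ transp-right y z ⟨
    transp y z z               ≡⟨ cong (transp y z) (transp-right z x) ⟨
    transp y z (transp z x x)  ∎
    where open ≡-Reasoning
  ... | is-y = begin
    transp x y (transp y z y)  ≡⟨ cong (transp x y) (transp-left y z) ⟩
    transp x y z               ≡⟨ transp-other (x≢z ∘ sym) (y≢z ∘ sym) ⟩
    z                          ≡⟨ transp-left y z ⟨
    transp y z y               ≡⟨ cong (transp y z) (transp-other (y≢z) (x≢y ∘ sym)) ⟨
    transp y z (transp z x y)  ∎
    where open ≡-Reasoning
  ... | is-z = begin
    transp x y (transp y z z)  ≡⟨ cong (transp x y) (transp-right y z) ⟩
    transp x y y               ≡⟨ transp-right x y ⟩
    x                          ≡⟨ transp-other x≢y x≢z ⟨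
    transp y z x               ≡⟨ cong (transp y z) (transp-left z x) ⟨
    transp y z (transp z x z)  ∎
    where open ≡-Reasoning
  ... | none m≢x m≢y m≢z = trans (transp²-fixes m≢x m≢y m≢y m≢z) (sym (transp²-fixes m≢y m≢z m≢z m≢x))

  module ThreeCycle {a : Perm n} (a-perm : IsPerm a) {i j k : Fin n} (i≢j : i ≢ j) (j≢k : j ≢ k) (i≢k : i ≢ k)
                    (ij-ascent : Ascent a i j) (jk-ascent : Ascent (swap a i j) j k) where

    g : Fin n → Fin n
    g m = transp i j (transp j k m)

    c c₂ c₃ b : Perm n
    c  = swap a i j
    c₂ = swap a j k
    c₃ = swap a k i
    b  = swap c j k

    b≡swap-c₂ : b ≡ swap c₂ k i
    b≡swap-c₂ = swap²-cong a (transp-rotate i≢j j≢k i≢k)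

    b≡swap-c₃ : b ≡ swap c₃ i j
    b≡swap-c₃ = swap²-cong a λ m →
      trans (transp-rotate i≢j j≢k i≢k m) (transp-rotate j≢k (i≢k ∘ sym) (i≢j ∘ sym) m)

    Valid : Perm n → Set
    Valid d = BEdge a d × BEdge d b

    exactly-one-valid : Xor (Valid c₂) (Valid c₃)
    exactly-one-valid = Xor-map (⇔-sym (a→c₂⇔ ×-⇔ c₂→b⇔)) (⇔-sym (a→c₃⇔ ×-⇔ c₃→b⇔))
      (three-point-pattern (i≢j ∘ toℕ-injective) (j≢k ∘ toℕ-injective) (i≢k ∘ toℕ-injective)
        (i≢j ∘ a-perm i j ∘ toℕ-injective) (j≢k ∘ a-perm j k ∘ toℕ-injective) (i≢k ∘ a-perm i k ∘ toℕ-injective)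
        (Ascent⇒SameOrder ij-ascent)
        (Equivalence.to (Ascent⇔SameOrder (swap-at-right a i j) (swap-outside a (i≢k ∘ sym) (j≢k ∘ sym))) jk-ascent))
      where
      a→c₂⇔ : BEdge a c₂ ⇔ SameOrder (toℕ j) (toℕ k) (toℕ (lookup a j)) (toℕ (lookup a k))
      a→c₂⇔ = Ascent⇔SameOrder refl refl ⇔-∘ BEdge-swap⇔Ascent {x = a} a-perm j≢k
      c₂→b⇔ : BEdge c₂ b ⇔ SameOrder (toℕ i) (toℕ k) (toℕ (lookup a i)) (toℕ (lookup a j))
      c₂→b⇔ = Ascent⇔SameOrder {x = c₂} (swap-outside a i≢j i≢k) (swap-at-right a j k)
               ⇔-∘ (Ascent-sym⇔ ⇔-∘ subst (λ y → BEdge c₂ y ⇔ Ascent c₂ k i) (sym b≡swap-c₂)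
                                        (BEdge-swap⇔Ascent (IsPerm-swap a j k a-perm) (i≢k ∘ sym)))
      a→c₃⇔ : BEdge a c₃ ⇔ SameOrder (toℕ i) (toℕ k) (toℕ (lookup a i)) (toℕ (lookup a k))
      a→c₃⇔ = Ascent⇔SameOrder refl refl ⇔-∘ (Ascent-sym⇔ ⇔-∘ BEdge-swap⇔Ascent {x = a} a-perm (i≢k ∘ sym))
      c₃→b⇔ : BEdge c₃ b ⇔ SameOrder (toℕ j) (toℕ i) (toℕ (lookup a j)) (toℕ (lookup a k))
      c₃→b⇔ = Ascent⇔SameOrder {x = c₃} (swap-outside a j≢k (i≢j ∘ sym)) (swap-at-right a k i)
               ⇔-∘ (Ascent-sym⇔ ⇔-∘ subst (λ y → BEdge c₃ y ⇔ Ascent c₃ i j) (sym b≡swap-c₃)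
                                        (BEdge-swap⇔Ascent (IsPerm-swap a k i a-perm) i≢j))

    g-moves-i : g i ≢ i
    g-moves-i gi≡i = i≢j (trans (sym gi≡i) (trans (cong (transp i j) (transp-other i≢j i≢k)) (transp-left i j)))

    candidates : ∀ {d} → BEdge a d → BEdge d b → d ≡ c ⊎ d ≡ c₂ ⊎ d ≡ c₃
    candidates a→d d→b with middle-factors a a-perm (lookup-swap² a i j j k) a→d d→b
    ... | p , q , p≢q , refl , _ , _ , factor with among₃ i j k p | among₃ i j k q
    ...   | is-x | is-x = contradiction refl p≢q
    ...   | is-x | is-y = inj₁ refl
    ...   | is-x | is-z = inj₂ (inj₂ (swap-sym a i k))
    ...   | is-y | is-x = inj₁ (swap-sym a j i)
    ...   | is-y | is-y = contradiction refl p≢q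
    ...   | is-y | is-z = inj₂ (inj₁ refl)
    ...   | is-z | is-x = inj₂ (inj₂ refl)
    ...   | is-z | is-y = inj₂ (inj₁ (swap-sym a k j))
    ...   | is-z | is-z = contradiction refl p≢q
    ...   | none p≢i p≢j p≢k | _ =
            contradiction (transp²-fixes p≢i p≢j p≢j p≢k) (Factorisation.moves-p factor p≢q g-moves-i)
    ...   | _ | none q≢i q≢j q≢k =
            contradiction (transp²-fixes q≢i q≢j q≢j q≢k) (Factorisation.moves-q factor p≢q g-moves-i)

    c₂≢c : c₂ ≢ c
    c₂≢c c₂≡c = i≢j (a-perm i j (trans (sym (swap-outside a i≢j i≢k))
                                       (trans (cong (λ x → lookup x i) c₂≡c) (swap-at-left a i j))))

    c₃≢c : c₃ ≢ c
    c₃≢c c₃≡c = i≢j (sym (a-perm j i (trans (sym (swap-outside a j≢k (i≢j ∘ sym)))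
                                            (trans (cong (λ x → lookup x j) c₃≡c) (swap-at-right a i j)))))

    choose : ∀ {x y} → x ≢ c → Valid x → ¬ Valid y →
             (∀ {d} → BEdge a d → BEdge d b → d ≡ c ⊎ d ≡ x ⊎ d ≡ y) → OtherMiddle a c b
    choose {x} {y} x≢c (a→x , x→b) ¬valid-y cands =
      record { c' = x ; c'≢c = x≢c ; a→c' = a→x ; c'→b = x→b ; only = only }
      where
      only : ∀ {d} → BEdge a d → BEdge d b → d ≡ c ⊎ d ≡ x
      only a→d d→b with cands a→d d→b
      ... | inj₁ d≡c         = inj₁ d≡c
      ... | inj₂ (inj₁ d≡x)  = inj₂ d≡x
      ... | inj₂ (inj₂ refl) = contradiction (a→d , d→b) ¬valid-y

    other-middle : OtherMiddle a c b
    other-middle with exactly-one-valid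
    ... | inj₁ (valid₂ , ¬valid₃) = choose c₂≢c valid₂ ¬valid₃ candidates
    ... | inj₂ (¬valid₂ , valid₃) = choose c₃≢c valid₃ ¬valid₂ λ a→d d→b → Sum.map₂ Sum.swap (candidates a→d d→b)

module _ {n : ℕ} where

  overlapping : ∀ {a c b : Perm n} → IsPerm a → ∀ {x y z} → x ≢ y → y ≢ z → x ≢ z →
                BEdge a c → BEdge c b → c ≡ swap a x y → b ≡ swap c y z → OtherMiddle a c b
  overlapping {a} a-perm {x} {y} {z} x≢y y≢z x≢z a→c c→b refl refl =
    ThreeCycle.other-middle a-perm x≢y y≢z x≢z
      (Equivalence.to (BEdge-swap⇔Ascent {x = a} a-perm x≢y) a→c)
      (Equivalence.to (BEdge-swap⇔Ascent {x = swap a x y} (IsPerm-swap a x y a-perm) y≢z) c→b)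

  bruhat-other-middle : ∀ {a c b : Perm n} → IsPerm a → BEdge a c → BEdge c b → OtherMiddle a c b
  bruhat-other-middle {a} a-perm a→c c→b with BEdge⇒AscentSwap {x = a} a-perm a→c
  ... | ascent-swap {i} {j} i≢j ij-ascent
    with BEdge⇒AscentSwap {x = swap a i j} (IsPerm-swap a i j a-perm) c→b
  ...   | ascent-swap {k} {l} k≢l kl-ascent = by-cases (k ≟ i) (k ≟ j) (l ≟ i) (l ≟ j)
    where
    c = swap a i j
    b = swap c k l
    not-back : b ≢ a
    not-back b≡a = <-irrefl refl (<-trans (proj₂ a→c) (subst (λ z → ℓ c ℕ.< ℓ z) b≡a (proj₂ c→b)))
    by-cases : Dec (k ≡ i) → Dec (k ≡ j) → Dec (l ≡ i) → Dec (l ≡ j) → OtherMiddle a c b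
    by-cases (yes k≡i) _ (yes l≡i) _ = contradiction (trans k≡i (sym l≡i)) k≢l
    by-cases _ (yes k≡j) _ (yes l≡j) = contradiction (trans k≡j (sym l≡j)) k≢l
    by-cases (yes k≡i) _ _ (yes l≡j) = contradiction (trans (cong₂ (swap c) k≡i l≡j) (swap-involutive a i j)) not-back
    by-cases _ (yes k≡j) (yes l≡i) _ =
      contradiction (trans (cong₂ (swap c) k≡j l≡i) (trans (swap-sym c j i) (swap-involutive a i j))) not-back
    by-cases (yes k≡i) _ (no l≢i) (no l≢j) = overlapping a-perm (i≢j ∘ sym) (l≢i ∘ sym) (l≢j ∘ sym) a→c c→b
      (swap-sym a i j) (cong (λ x → swap c x l) k≡i)
    by-cases (no _) (yes k≡j) (no l≢i) (no l≢j) = overlapping a-perm i≢j (l≢j ∘ sym) (l≢i ∘ sym) a→c c→b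
      refl (cong (λ x → swap c x l) k≡j)
    by-cases (no k≢i) (no k≢j) (yes l≡i) _ = overlapping a-perm (i≢j ∘ sym) (k≢i ∘ sym) (k≢j ∘ sym) a→c c→b
      (swap-sym a i j) (trans (cong (swap c k) l≡i) (swap-sym c k i))
    by-cases (no k≢i) (no k≢j) (no _) (yes l≡j) = overlapping a-perm i≢j (k≢j ∘ sym) (k≢i ∘ sym) a→c c→b
      refl (trans (cong (swap c k) l≡j) (swap-sym c k j))
    by-cases (no k≢i) (no k≢j) (no l≢i) (no l≢j) =
      Disjoint.other-middle a-perm i≢j k≢l k≢i k≢j l≢i l≢j ij-ascent kl-ascent

-- Paths and flips

module _ {h : ℕ} where

  Succ : Fin (suc h) → Fin (suc h) → Set
  Succ p q = toℕ q ≡ suc (toℕ p)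

  Succ⇒≢ : ∀ {p q} → Succ p q → p ≢ q
  Succ⇒≢ {p} q≡1+p p≡q = 1+n≢n (trans (sym q≡1+p) (cong toℕ (sym p≡q)))

  Succ-step : ∀ {p q} → Succ p q → Σ (Fin h) λ t → inject₁ t ≡ p × Fin.suc t ≡ q
  Succ-step {p} {q} q≡1+p = fromℕ< p<h ,
    toℕ-injective (trans (toℕ-inject₁ (fromℕ< p<h)) (toℕ-fromℕ< p<h)) ,
    toℕ-injective (trans (cong suc (toℕ-fromℕ< p<h)) (sym q≡1+p))
    where
    p<h : toℕ p ℕ.< h
    p<h = ≤-trans (≤-reflexive (sym q≡1+p)) (≤-pred (toℕ<n q))

  step-Succ : (t : Fin h) → Succ (inject₁ t) (Fin.suc t)
  step-Succ t = cong suc (sym (toℕ-inject₁ t))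

  Succ-unique : ∀ {p p' q} → Succ p q → Succ p' q → p ≡ p'
  Succ-unique q≡1+p q≡1+p' = toℕ-injective (ℕ.suc-injective (trans (sym q≡1+p) q≡1+p'))

  Succ-functional : ∀ {p q q' : Fin (suc h)} → Succ p q → Succ p q' → q ≡ q'
  Succ-functional q≡1+p q'≡1+p = toℕ-injective (trans q≡1+p (sym q'≡1+p))

  Succ-zero : ∀ {p q} → Succ p q → Fin.zero ≢ q
  Succ-zero q≡1+p 0≡q = 0≢1+n (trans (cong toℕ 0≡q) q≡1+p)

  Succ-last : ∀ {q r} → Succ q r → fromℕ h ≢ q
  Succ-last {q} {r} r≡1+q h≡q = <-irrefl (trans (sym (cong toℕ h≡q)) (toℕ-fromℕ h)) q<h
    where
    q<h : toℕ q ℕ.< h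
    q<h = ≤-trans (≤-reflexive (sym r≡1+q)) (≤-pred (toℕ<n r))

module _ {n h : ℕ} where

  IsBPath-Succ : ∀ {Γ : BPath n h} → IsBPath Γ → ∀ {p q} → Succ p q → BEdge (lookup Γ p) (lookup Γ q)
  IsBPath-Succ {Γ} Γ-path q≡1+p with t , refl , refl ← Succ-step q≡1+p = Γ-path t

  IsPerm-along : ∀ {Γ : BPath n h} → IsBPath Γ → IsPerm (lookup Γ Fin.zero) → ∀ t → IsPerm (lookup Γ t)
  IsPerm-along {Γ} Γ-path Γ₀-perm = <-weakInduction (IsPerm ∘ lookup Γ) Γ₀-perm
    λ t x-perm → IsPerm-BEdge {x = lookup Γ (inject₁ t)} x-perm (Γ-path t)

  Flip-update : ∀ {Γ : BPath n h} {p q r z} → Consec p q r →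
                BEdge (lookup Γ p) z → BEdge z (lookup Γ r) → z ≢ lookup Γ q → Flip Γ (Γ [ q ]≔ z)
  Flip-update {Γ} {p} {q} {r} {z} consec p→z z→r z≢ =
    p , q , r , consec , (λ t t≢q → sym (lookup∘update′ t≢q Γ z)) ,
    subst (_≢ lookup Γ q) (sym (lookup∘update q Γ z)) z≢ ,
    subst (BEdge (lookup Γ p)) (sym (lookup∘update q Γ z)) p→z ,
    subst (λ x → BEdge x (lookup Γ r)) (sym (lookup∘update q Γ z)) z→r

  Flip-sym : ∀ {Γ Γ' : BPath n h} → IsBPath Γ → Flip Γ Γ' → Flip Γ' Γ
  Flip-sym {Γ} {Γ'} Γ-path (p , q , r , consec@(q≡1+p , r≡1+q) , agree , new≢ , _ , _) =
    p , q , r , consec , (λ t t≢q → sym (agree t t≢q)) , (λ eq → new≢ (sym eq)) ,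
    subst (λ x → BEdge x (lookup Γ q)) (agree p (Succ⇒≢ q≡1+p)) (IsBPath-Succ {Γ = Γ} Γ-path q≡1+p) ,
    subst (BEdge (lookup Γ q)) (agree r (Succ⇒≢ r≡1+q ∘ sym)) (IsBPath-Succ {Γ = Γ} Γ-path r≡1+q)

Star-respects : ∀ {A : Set} {R : A → A → Set} {P : A → Set} → P Respects R → P Respects (Star R)
Star-respects resp ε        = λ px → px
Star-respects resp (r ◅ rs) = Star-respects resp rs ∘ resp r

module _ {n h : ℕ} where

  Flip-preserves-InP : ∀ {u v : Perm n} → InP h u v Respects Flip
  Flip-preserves-InP {x = Γ} {Γ'} (p , q , r , (q≡1+p , r≡1+q) , agree , _ , p→z , z→r) (Γ-path , Γ-start , Γ-end) =
    Γ'-path , trans (sym (agree _ (Succ-zero q≡1+p))) Γ-start , trans (sym (agree _ (Succ-last r≡1+q))) Γ-end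
    where
    Γ'-path : IsBPath Γ'
    Γ'-path t with inject₁ t ≟ q | Fin.suc t ≟ q
    ... | yes refl | _ = subst (BEdge (lookup Γ' q))
            (trans (agree r (Succ⇒≢ r≡1+q ∘ sym)) (cong (lookup Γ') (Succ-functional r≡1+q (step-Succ t)))) z→r
    ... | no _ | yes refl = subst (λ x → BEdge x (lookup Γ' q))
            (trans (agree p (Succ⇒≢ q≡1+p)) (cong (lookup Γ') (Succ-unique q≡1+p (step-Succ t)))) p→z
    ... | no t≢q | no t+1≢q = subst₂ BEdge (agree _ t≢q) (agree _ t+1≢q) (Γ-path t)

splice : ∀ {A : Set} {m} → (Fin m → A) → A → (Fin m → A) → Fin m → Fin m → A
splice f c g t s with Fin.<-cmp s t
... | tri< _ _ _ = f s
... | tri≈ _ _ _ = c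
... | tri> _ _ _ = g s

module _ {A : Set} {m} (f : Fin m → A) (c : A) (g : Fin m → A) (t : Fin m) where

  splice-< : ∀ {s} → s Fin.< t → splice f c g t s ≡ f s
  splice-< {s} s<t with Fin.<-cmp s t
  ... | tri< _ _ _    = refl
  ... | tri≈ ¬s<t _ _ = contradiction s<t ¬s<t
  ... | tri> ¬s<t _ _ = contradiction s<t ¬s<t

  splice-≡ : splice f c g t t ≡ c
  splice-≡ with Fin.<-cmp t t
  ... | tri< _ t≢t _ = contradiction refl t≢t
  ... | tri≈ _ _ _   = refl
  ... | tri> _ t≢t _ = contradiction refl t≢t

  splice-> : ∀ {s} → t Fin.< s → splice f c g t s ≡ g s
  splice-> {s} t<s with Fin.<-cmp s t
  ... | tri< _ _ ¬t<s = contradiction t<s ¬t<s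
  ... | tri≈ _ _ ¬t<s = contradiction t<s ¬t<s
  ... | tri> _ _ _    = refl

-- The time-support graph

module TimeSupport {n h : ℕ} {u v : Perm n} (u-perm : IsPerm u) (Γ₀ : BPath n h) (Γ₀∈P : InP h u v Γ₀) where

  open TS Γ₀

  F-InP : ∀ {Γ} → F Γ → InP h u v Γ
  F-InP Γ₀⇝Γ = Star-respects {P = InP h u v} (λ {Γ} {Γ'} → Flip-preserves-InP {x = Γ} {Γ'}) Γ₀⇝Γ Γ₀∈P

  F-perm : ∀ {Γ} → F Γ → ∀ t → IsPerm (lookup Γ t)
  F-perm {Γ} fΓ = IsPerm-along {Γ = Γ} Γ-path (subst IsPerm (sym Γ-start) u-perm)
    where
    Γ-path : IsBPath Γ
    Γ-path = proj₁ (F-InP fΓ)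
    Γ-start : lookup Γ Fin.zero ≡ u
    Γ-start = proj₁ (proj₂ (F-InP fΓ))

  F-extend : ∀ {Γ Γ'} → F Γ → Flip Γ Γ' → F Γ'
  F-extend fΓ flip = fΓ ◅◅ (flip ◅ ε)

  time : V → ℕ
  time = toℕ ∘ proj₂

  Edge-time : ∀ {x y} → Edge x y → time y ≡ suc (time x)
  Edge-time (t , refl , refl , _) = step-Succ t

  Star-time : ∀ {x y} → Star Edge x y → time x ℕ.≤ time y
  Star-time ε        = ≤-refl
  Star-time (e ◅ es) = ≤-trans (≤-trans (n≤1+n _) (≤-reflexive (sym (Edge-time e)))) (Star-time es)

  Star-same-time : ∀ {x y} → Star Edge x y → time x ≡ time y → x ≡ y
  Star-same-time ε        _   = refl
  Star-same-time (e ◅ es) x≡y =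
    contradiction (≤-trans (≤-reflexive (sym (Edge-time e))) (Star-time es)) (<-irrefl x≡y)

  Edge⇒BEdge : ∀ {a i b k} → Edge (a , i) (b , k) → BEdge a b
  Edge⇒BEdge (t , refl , refl , Γ , fΓ , refl , refl) = proj₁ (F-InP fΓ) t

  F-Vert : ∀ {Γ} → F Γ → ∀ t → Vert (lookup Γ t , t)
  F-Vert {Γ} fΓ t = Γ , fΓ , refl

  F-Edge : ∀ {Γ} → F Γ → ∀ {p q} → Succ p q → Edge (lookup Γ p , p) (lookup Γ q , q)
  F-Edge {Γ} fΓ q≡1+p with t , refl , refl ← Succ-step q≡1+p = t , refl , refl , Γ , fΓ , refl , refl

  Edge⇒≤ : ∀ {x y} → Edge x y → x ≤ y
  Edge⇒≤ e@(_ , refl , refl , Γ , fΓ , refl , refl) = F-Vert fΓ _ , F-Vert fΓ _ , e ◅ ε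

  Vert⇒≤-refl : ∀ {x} → Vert x → x ≤ x
  Vert⇒≤-refl vx = vx , vx , ε

  interval-of-length-two : ∀ {x y z} → Star Edge x z → Star Edge z y → time y ≡ 2 + time x →
                           z ≡ x ⊎ z ≡ y ⊎ (Edge x z × Edge z y)
  interval-of-length-two ε         _         _       = inj₁ refl
  interval-of-length-two (_ ◅ _)   ε         _       = inj₂ (inj₁ refl)
  interval-of-length-two {x} {y} {z} (_◅_ {j = w} e₁ es₁) (_◅_ {j = w'} e₂ es₂) y≡2+x =
    inj₂ (inj₂ (subst (Edge x) w≡z e₁ , subst (Edge z) w'≡y e₂))
    where
    z≡1+x : time z ≡ suc (time x)
    z≡1+x = ≤-antisym
      (≤-pred (≤-trans (≤-reflexive (sym (Edge-time e₂))) (≤-trans (Star-time es₂) (≤-reflexive y≡2+x))))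
      (≤-trans (≤-reflexive (sym (Edge-time e₁))) (Star-time es₁))
    w≡z : w ≡ z
    w≡z = Star-same-time es₁ (trans (Edge-time e₁) (sym z≡1+x))
    w'≡y : w' ≡ y
    w'≡y = Star-same-time es₂ (trans (Edge-time e₂) (trans (cong suc z≡1+x) (sym y≡2+x)))

  middle-of-length-two : ∀ {x y} → Star Edge x y → time y ≡ 2 + time x → Σ V λ w → Edge x w × Edge w y
  middle-of-length-two ε       y≡2+x = contradiction y≡2+x (m≢1+n+m _)
  middle-of-length-two (e ◅ ε) y≡2+x = contradiction (trans (sym (Edge-time e)) y≡2+x) (m≢1+n+m _ {0})
  middle-of-length-two (_◅_ {j = w} e₁ (e₂ ◅ es)) y≡2+x =
    w , e₁ , subst (Edge w) (Star-same-time es (trans (Edge-time e₂) (trans (cong suc (Edge-time e₁)) (sym y≡2+x)))) e₂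

  lookup-iTS : ∀ Γ t → lookup (iTS Γ) t ≡ (lookup Γ t , t)
  lookup-iTS Γ = lookup∘tabulate (λ t → lookup Γ t , t)

  time-iTS : ∀ Γ t → time (lookup (iTS Γ) t) ≡ toℕ t
  time-iTS Γ t = cong (toℕ ∘ proj₂) (lookup-iTS Γ t)

  iTS-injective : ∀ {Γ Γ'} → iTS Γ ≡ iTS Γ' → Γ ≡ Γ'
  iTS-injective {Γ} {Γ'} eq = vec-ext λ t →
    cong proj₁ (trans (sym (lookup-iTS Γ t)) (trans (cong (λ π → lookup π t) eq) (lookup-iTS Γ' t)))

  iTS-InPTS : ∀ {Γ} → F Γ → InPTS u v (iTS Γ)
  iTS-InPTS {Γ} fΓ =
    (λ t → subst₂ Edge (sym (lookup-iTS Γ _)) (sym (lookup-iTS Γ _)) (F-Edge fΓ (step-Succ t))) ,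
    trans (lookup-iTS Γ _) (cong (_, _) Γ-start) , trans (lookup-iTS Γ _) (cong (_, _) Γ-end)
    where
    Γ-start : lookup Γ Fin.zero ≡ u
    Γ-start = proj₁ (proj₂ (F-InP fΓ))
    Γ-end : lookup Γ (fromℕ h) ≡ v
    Γ-end = proj₂ (proj₂ (F-InP fΓ))

  Effective : TSPath → Set
  Effective π = Σ (BPath n h) λ Γ → F Γ × iTS Γ ≡ π

  Flip'-preserves-Effective : ∀ {π π'} → Flip' π π' → Effective π → Effective π'
  Flip'-preserves-Effective {π' = π'} (p , q , r , consec@(q≡1+p , r≡1+q) , agree , (p≤z , z≤r) , z≢p , z≢r , z≢q)
                            (Γ , fΓ , refl)
    with interval-of-length-two (proj₂ (proj₂ p≤z)) (proj₂ (proj₂ z≤r)) r≡2+p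
    where
    r≡2+p : time (lookup (iTS Γ) r) ≡ 2 + time (lookup (iTS Γ) p)
    r≡2+p = trans (time-iTS Γ r) (trans r≡1+q (cong suc (trans q≡1+p (cong suc (sym (time-iTS Γ p))))))
  ... | inj₁ z≡p                = contradiction z≡p z≢p
  ... | inj₂ (inj₁ z≡r)         = contradiction z≡r z≢r
  ... | inj₂ (inj₂ (p→z , z→r)) = Γ [ q ]≔ c , F-extend fΓ flip , vec-ext agree'
    where
    c : Perm n
    c = proj₁ (lookup π' q)
    z-time : proj₂ (lookup π' q) ≡ q
    z-time = toℕ-injective (trans (Edge-time p→z) (trans (cong suc (time-iTS Γ p)) (sym q≡1+p)))
    flip : Flip Γ (Γ [ q ]≔ c)
    flip = Flip-update {Γ = Γ} consec
      (subst (λ x → BEdge x c) (cong proj₁ (lookup-iTS Γ p)) (Edge⇒BEdge p→z))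
      (subst (BEdge c) (cong proj₁ (lookup-iTS Γ r)) (Edge⇒BEdge z→r))
      (λ c≡Γq → z≢q (trans (cong₂ _,_ c≡Γq z-time) (sym (lookup-iTS Γ q))))
    agree' : ∀ s → lookup (iTS (Γ [ q ]≔ c)) s ≡ lookup π' s
    agree' s with s ≟ q
    ... | yes refl = trans (lookup-iTS (Γ [ q ]≔ c) s) (cong₂ _,_ (lookup∘update s Γ c) (sym z-time))
    ... | no s≢q   = trans (lookup-iTS (Γ [ q ]≔ c) s)
                       (trans (cong (_, s) (lookup∘update′ s≢q Γ c)) (trans (sym (lookup-iTS Γ s)) (agree s s≢q)))

  Cond2⇒Cond1 : Cond2 u v → Cond1 u v
  Cond2⇒Cond1 (_ , transitive) = (λ _ _ _ _ → iTS-injective) , λ π π∈P →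
    Star-respects {P = Effective} (λ {π} {π'} → Flip'-preserves-Effective {π} {π'})
      (transitive _ π (iTS-InPTS ε) π∈P) (Γ₀ , ε , refl)

  Flip⇒Flip' : ∀ {Γ Γ'} → F Γ → Flip Γ Γ' → Flip' (iTS Γ) (iTS Γ')
  Flip⇒Flip' {Γ} {Γ'} fΓ flip@(p , q , r , consec@(q≡1+p , r≡1+q) , agree , new≢ , _ , _) =
    p , q , r , consec , agree' , (p≤z , z≤r) ,
    at-other-time (Succ⇒≢ q≡1+p ∘ sym) , at-other-time (Succ⇒≢ r≡1+q) , z≢q
    where
    p≢q : p ≢ q
    p≢q = Succ⇒≢ q≡1+p
    r≢q : r ≢ q
    r≢q = Succ⇒≢ r≡1+q ∘ sym
    fΓ' : F Γ'
    fΓ' = F-extend {Γ' = Γ'} fΓ flip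
    agree' : AgreeOff q (iTS Γ) (iTS Γ')
    agree' s s≢q = trans (lookup-iTS Γ s) (trans (cong (_, s) (agree s s≢q)) (sym (lookup-iTS Γ' s)))
    at-other-time : ∀ {s s'} → s ≢ s' → lookup (iTS Γ') s ≢ lookup (iTS Γ) s'
    at-other-time s≢s' eq = s≢s' (cong proj₂ (trans (sym (lookup-iTS Γ' _)) (trans eq (lookup-iTS Γ _))))
    z≢q : lookup (iTS Γ') q ≢ lookup (iTS Γ) q
    z≢q eq = new≢ (cong proj₁ (trans (sym (lookup-iTS Γ' q)) (trans eq (lookup-iTS Γ q))))
    p≤z : lookup (iTS Γ) p ≤ lookup (iTS Γ') q
    p≤z = subst₂ _≤_ (sym (trans (agree' p p≢q) (lookup-iTS Γ' p))) (sym (lookup-iTS Γ' q))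
                     (Edge⇒≤ (F-Edge fΓ' q≡1+p))
    z≤r : lookup (iTS Γ') q ≤ lookup (iTS Γ) r
    z≤r = subst₂ _≤_ (sym (lookup-iTS Γ' q)) (sym (trans (agree' r r≢q) (lookup-iTS Γ' r)))
                     (Edge⇒≤ (F-Edge fΓ' r≡1+q))

  lift : ∀ {Γ Γ'} → F Γ → Star Flip Γ Γ' → Star Flip' (iTS Γ) (iTS Γ')
  lift fΓ ε = ε
  lift {Γ} fΓ (_◅_ {j = Γ'} flip flips) =
    Flip⇒Flip' {Γ} {Γ'} fΓ flip ◅ lift (F-extend {Γ' = Γ'} fΓ flip) flips

  flip-back : ∀ {Γ Γ'} → F Γ → Star Flip Γ Γ' → Star Flip Γ' Γ
  flip-back fΓ ε = ε
  flip-back {Γ} fΓ (_◅_ {j = Γ'} flip flips) =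
    flip-back (F-extend {Γ' = Γ'} fΓ flip) flips ◅◅ (Flip-sym {Γ = Γ} {Γ'} (proj₁ (F-InP fΓ)) flip ◅ ε)

  transitive : Cond1 u v → ∀ π π' → InPTS u v π → InPTS u v π' → Star Flip' π π'
  transitive (_ , surjective) π π' π∈P π'∈P
    with Γ , fΓ , refl ← surjective π π∈P | Γ' , fΓ' , refl ← surjective π' π'∈P =
    lift fΓ (flip-back ε fΓ ◅◅ fΓ')

  module Splice {a b c : Perm n} {i t k : Fin (suc h)} {Γa Γb : BPath n h}
                (fa : F Γa) (Γa-i : lookup Γa i ≡ a) (fb : F Γb) (Γb-k : lookup Γb k ≡ b)
                (e₁ : Edge (a , i) (c , t)) (e₂ : Edge (c , t) (b , k)) where

    t≡1+i : Succ i t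
    t≡1+i = Edge-time e₁

    k≡1+t : Succ t k
    k≡1+t = Edge-time e₂

    ρ : Fin (suc h) → Perm n
    ρ = splice (lookup Γa) c (lookup Γb) t

    Δ : BPath n h
    Δ = tabulate ρ

    Δ-before : ∀ {s} → s Fin.< t → lookup Δ s ≡ lookup Γa s
    Δ-before {s} s<t = trans (lookup∘tabulate ρ s) (splice-< (lookup Γa) c (lookup Γb) t s<t)

    Δ-t : lookup Δ t ≡ c
    Δ-t = trans (lookup∘tabulate ρ t) (splice-≡ (lookup Γa) c (lookup Γb) t)

    Δ-after : ∀ {s} → t Fin.< s → lookup Δ s ≡ lookup Γb s
    Δ-after {s} t<s = trans (lookup∘tabulate ρ s) (splice-> (lookup Γa) c (lookup Γb) t t<s)

    i<t : i Fin.< t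
    i<t = ≤-reflexive (sym t≡1+i)

    t<k : t Fin.< k
    t<k = ≤-reflexive (sym k≡1+t)

    Δ-i : lookup Δ i ≡ a
    Δ-i = trans (Δ-before i<t) Γa-i

    Δ-k : lookup Δ k ≡ b
    Δ-k = trans (Δ-after t<k) Γb-k

    Δ-edge : ∀ {s s'} → Succ s s' → Edge (lookup Δ s , s) (lookup Δ s' , s')
    Δ-edge {s} {s'} s'≡1+s with Fin.<-cmp s' t
    ... | tri< s'<t _ _ = subst₂ (λ x y → Edge (x , s) (y , s'))
            (sym (Δ-before (<-≤-trans (≤-reflexive (sym s'≡1+s)) (≤-trans (n≤1+n _) s'<t))))
            (sym (Δ-before s'<t)) (F-Edge fa s'≡1+s)
    ... | tri≈ _ refl _ = subst (λ x → Edge (lookup Δ x , x) (lookup Δ t , t)) (sym (Succ-unique s'≡1+s t≡1+i))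
            (subst₂ (λ x y → Edge (x , i) (y , t)) (sym Δ-i) (sym Δ-t) e₁)
    ... | tri> _ _ t<s' with Fin.<-cmp s t
    ...   | tri< s<t _ _ = contradiction (≤-pred (≤-trans t<s' (≤-reflexive s'≡1+s))) (<⇒≱ s<t)
    ...   | tri≈ _ refl _ = subst (λ y → Edge (lookup Δ t , t) (lookup Δ y , y)) (Succ-functional k≡1+t s'≡1+s)
            (subst₂ (λ x y → Edge (x , t) (y , k)) (sym Δ-t) (sym Δ-k) e₂)
    ...   | tri> _ _ t<s = subst₂ (λ x y → Edge (x , s) (y , s')) (sym (Δ-after t<s)) (sym (Δ-after t<s'))
            (F-Edge fb s'≡1+s)

    Δ-InPTS : InPTS u v (iTS Δ)
    Δ-InPTS =
      (λ s → subst₂ Edge (sym (lookup-iTS Δ _)) (sym (lookup-iTS Δ _)) (Δ-edge (step-Succ s))) ,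
      trans (lookup-iTS Δ _) (cong (_, _) (trans (Δ-before 0<t) Γa-start)) ,
      trans (lookup-iTS Δ _) (cong (_, _) (trans (Δ-after t<h) Γb-end))
      where
      Γa-start : lookup Γa Fin.zero ≡ u
      Γa-start = proj₁ (proj₂ (F-InP fa))
      Γb-end : lookup Γb (fromℕ h) ≡ v
      Γb-end = proj₂ (proj₂ (F-InP fb))
      0<t : Fin.zero {h} Fin.< t
      0<t = subst (λ x → 0 ℕ.< x) (sym t≡1+i) (s≤s z≤n)
      t<h : t Fin.< fromℕ h
      t<h = <-≤-trans t<k (subst (toℕ k ℕ.≤_) (sym (toℕ-fromℕ h)) (toℕ≤pred[n] k))

  different-middles-incomparable : ∀ {c c' : Perm n} {t} → c ≢ c' → ¬ ((c , t) ≤ (c' , t))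
  different-middles-incomparable c≢c' (_ , _ , c⇝c') = c≢c' (cong proj₁ (Star-same-time c⇝c' refl))

  interval-elements : ∀ {a b c c' : Perm n} {i t k} → Succ i t → toℕ k ≡ 2 + toℕ i →
    (∀ {d} → BEdge a d → BEdge d b → d ≡ c ⊎ d ≡ c') →
    ∀ z → Interval (a , i) (b , k) z → z ≡ (a , i) ⊎ z ≡ (b , k) ⊎ z ≡ (c , t) ⊎ z ≡ (c' , t)
  interval-elements {a} {b} {c} {c'} {i} {t} {k} t≡1+i k≡2+i only (d , s) ((_ , _ , ai⇝ds) , (_ , _ , ds⇝bk)) =
    Sum.map₂ (Sum.map₂ middle) (interval-of-length-two ai⇝ds ds⇝bk k≡2+i)
    where
    middle : Edge (a , i) (d , s) × Edge (d , s) (b , k) → (d , s) ≡ (c , t) ⊎ (d , s) ≡ (c' , t)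
    middle (ai→ds , ds→bk) = Sum.map (λ d≡c → cong₂ _,_ d≡c s≡t) (λ d≡c' → cong₂ _,_ d≡c' s≡t)
                                     (only (Edge⇒BEdge ai→ds) (Edge⇒BEdge ds→bk))
      where
      s≡t : s ≡ t
      s≡t = toℕ-injective (trans (Edge-time ai→ds) (sym t≡1+i))

  diamond : Cond1 u v → ∀ a b i k → toℕ k ≡ 2 + toℕ i → (a , i) ≤ (b , k) → IsDiamond (Interval (a , i) (b , k))
  diamond (_ , surjective) a b i k k≡2+i ai≤bk@(ai-vertex@(Γa , fa , Γa-i) , bk-vertex@(Γb , fb , Γb-k) , ai⇝bk)
    with (c , t) , e₁ , e₂ ← middle-of-length-two ai⇝bk k≡2+i =
    (a , i) , (b , k) , (c , t) , (c' , t) ,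
    (Vert⇒≤-refl ai-vertex , ai≤bk) , (ai≤bk , Vert⇒≤-refl bk-vertex) ,
    (Edge⇒≤ e₁ , Edge⇒≤ e₂) , (Edge⇒≤ e₁' , Edge⇒≤ e₂') ,
    (λ _ z∈I → z∈I) , interval-elements t≡1+i k≡2+i only ,
    different-middles-incomparable (c'≢c ∘ sym) , different-middles-incomparable c'≢c
    where
    open Splice fa Γa-i fb Γb-k e₁ e₂
    -- Δ is a path of TS through a, c and b; by surjectivity it comes from the flipclass.
    fΔ : F Δ
    fΔ with Γ , fΓ , iTSΓ≡iTSΔ ← surjective (iTS Δ) Δ-InPTS = subst F (iTS-injective iTSΓ≡iTSΔ) fΓ
    open OtherMiddle (bruhat-other-middle {a = a} {c} {b} (subst IsPerm Δ-i (F-perm fΔ i)) (Edge⇒BEdge e₁) (Edge⇒BEdge e₂))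
    fΔ' : F (Δ [ t ]≔ c')
    fΔ' = F-extend {Γ' = Δ [ t ]≔ c'} fΔ (Flip-update {Γ = Δ} (t≡1+i , k≡1+t)
      (subst (λ x → BEdge x c') (sym Δ-i) a→c') (subst (BEdge c') (sym Δ-k) c'→b)
      (λ c'≡Δt → c'≢c (trans c'≡Δt Δ-t)))
    Δ'-agrees : ∀ {s} → s ≢ t → lookup (Δ [ t ]≔ c') s ≡ lookup Δ s
    Δ'-agrees s≢t = lookup∘update′ s≢t Δ c'
    e₁' : Edge (a , i) (c' , t)
    e₁' = subst₂ (λ x y → Edge (x , i) (y , t)) (trans (Δ'-agrees (Succ⇒≢ t≡1+i)) Δ-i) (lookup∘update t Δ c')
            (F-Edge fΔ' t≡1+i)
    e₂' : Edge (c' , t) (b , k)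
    e₂' = subst₂ (λ x y → Edge (x , t) (y , k)) (lookup∘update t Δ c') (trans (Δ'-agrees (Succ⇒≢ k≡1+t ∘ sym)) Δ-k)
            (F-Edge fΔ' k≡1+t)

  Cond1⇒Cond2 : Cond1 u v → Cond2 u v
  Cond1⇒Cond2 cond1 = diamond cond1 , transitive cond1

lemma5p7 : (n h : ℕ) (u v : Perm n) → IsPerm u → IsPerm v → u <B v →
    (Γ₀ : BPath n h) → InP h u v Γ₀ →
    TS.Cond1 Γ₀ u v ⇔ TS.Cond2 Γ₀ u v
lemma5p7 n h u v u-perm _ _ Γ₀ Γ₀∈P = mk⇔ Cond1⇒Cond2 Cond2⇒Cond1
  where open TimeSupport u-perm Γ₀ Γ₀∈P
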